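{- Let $p$ be a prime with $p\nmid\mathrm{Vol}(\Delta)$ and $p>(n+4)D$, and let $k\ge1$. Then, up to sign, $$\det(\widetilde e^{\mathrm{res}}_{pQ-Q'})_{Q,Q'\in\Delta_k^\pm}=\prod_{P_0\in\Delta^- }\ \prod_{I\subseteq I(P_0)}\det\big(\widetilde e^{\mathrm{res}}_{P_0-\eta(P_0)+pQ-Q'}\big)_{Q,Q'\in\Delta_k^\pm(I,P_0)},$$ where the determinant over an empty index set is $1$.
   Context: Fix $n\ge1$ and linearly independent $\mathbf V_1,\dots,\mathbf V_n\in\mathbb Z^n$; $\Delta=\{\sum_iz_i\mathbf V_i:0\le z_i\le1\}$ with Euclidean volume $\mathrm{Vol}(\Delta)$, origin $\mathcal O$, $\Delta_1^+=\Delta\cap\mathbb Z^n$; $\mathbb M(\Delta)=\{\sum_iz_i\mathbf V_i:z_i\ge0\}\cap\mathbb Z^n$; $D$ the smallest positive integer with all coordinates of elements of $\mathbb M(\Delta)$ in $\frac1D\mathbb Z_{\ge0}$. For $k\ge0$: $\Delta_k^+=\{\sum_iz_i\mathbf V_i\in\mathbb Z^n:0\le z_i\le k\}$, $\Delta_k^-=\{\sum_iz_i\mathbf V_i\in\mathbb Z^n:0\le z_i<k\}$, $\Delta^-=\Delta_1^-$. For $P_0=\sum_ir_i\mathbf V_i\in\Delta^-$, $I(P_0)=\{i:r_i=0\}$. For $I\subseteq\{1,\dots,n\}$, $\Delta_k^\pm(I)=\{\sum_iz_i\mathbf V_i\in\Delta_k^\pm:z_i=0\text{ for }i\in I,\ z_i>0\text{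 for }i\notin I\}$; $\Delta_k^\pm(P_0)=\{Q\in\Delta_k^\pm:Q-P_0\in\bigoplus_i\mathbb Z\mathbf V_i\}$; $\Delta_k^\pm(I,P_0)=\Delta_k^\pm(I)\cap\Delta_k^\pm(P_0)$. $\eta:\Delta^-\to\Delta^-$ sends $Q$ to the unique element of $\Delta^-$ congruent to $pQ$ modulo $\bigoplus_i\mathbb Z\mathbf V_i$. $E(\pi)=\exp(\sum_{i\ge0}\pi^{p^i}/p^i)$, $E(\pi)=1+T$. With indeterminates $\widetilde a_P$ ($P\in\Delta_1^+\setminus\{\mathcal O\}$), $\widetilde e_Q(T)$ is the coefficient of $\underline x^Q$ in $\prod_{P\in\Delta_1^+\setminus\{\mathcal O\}}E(\widetilde a_P\pi\underline x^P)$ (zero if it does not occur). For nonempty $S\subseteq\{1,\dots,n\}$, $\mathbf V_S=\sum_{i\in S}\mathbf V_i$; $\widetilde e^{\mathrm{res}}_Q$ is obtained from $\widetilde e_Q$ by setting $\widetilde a_P=0$ for $P$ not of the form $\mathbf V_S$ and $\widetilde a_{\mathbf V_S}=\widetilde a_{\#S}$ for new indeterminates $\widetilde a_1,\dots,\widetilde a_n$. Determinants of matrices indexed by finite sets (rows by $Q$, columns by $Q'$) are defined up to sign. -}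

module Defs where

open import Level using (0ℓ)
open import Data.Bool using (Bool; true; false; if_then_else_; _∧_; _∨_; not)
open import Data.Nat as ℕ using (ℕ; zero; suc; _∸_; _!; _≡ᵇ_)
open import Data.Nat.Divisibility using (_∣_)
open import Data.Nat.Primality using (Prime)
open import Data.Integer as ℤ using (ℤ; +_; -[1+_])
import Data.Integer.Properties as ℤP
open import Data.Rational as ℚ using (ℚ; 0ℚ; 1ℚ)
import Data.Rational.Properties as ℚP
open import Data.Fin using (Fin)
open import Data.Fin.Subset using (Subset; inside; outside; ∣_∣; ⊥)
open import Data.Vec as Vec using (Vec; []; _∷_)
open import Data.List as List using (List; []; _∷_; _++_; allFin; filterᵇ; length)
open import Data.List.Membership.Propositional using (_∈_)
open import Data.List.Relation.Unary.Unique.Propositional using (Unique)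
open import Data.Product using (Σ; _×_; _,_)
open import Data.Sum using (_⊎_)
open import Data.Maybe using (Maybe; just; nothing)
open import Function.Bundles using (_⇔_)
open import Relation.Binary.PropositionalEquality using (_≡_)
open import Relation.Nullary using (¬_; does)
open import Algebra.Bundles using (CommutativeRing)
open import Algebra.Morphism.Structures using (module RingMorphisms)

module Det {c ℓ} (R : CommutativeRing c ℓ) where
  open CommutativeRing R

  sgn : ℕ → Carrier
  sgn zero = 1#
  sgn (suc zero) = - 1#
  sgn (suc (suc j)) = sgn j

  mutual
    det : {A : Set} → (A → A → Carrier) → List A → List A → Carrier
    det M [] cs = 1#
    det M (r ∷ rs) cs = expand M r rs [] cs

    expand : {A : Set} → (A → A → Carrier) → A → List A → List A → List A → Carrier
    expand M r rs pre [] = 0#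
    expand M r rs pre (c' ∷ post) =
      (sgn (length pre) * M r c' * det M rs (pre ++ post))
        + expand M r rs (pre ++ (c' ∷ [])) post

  sumL : {A : Set} → (A → Carrier) → List A → Carrier
  sumL f xs = List.foldr (λ x acc → f x + acc) 0# xs

  prodL : {A : Set} → (A → Carrier) → List A → Carrier
  prodL f xs = List.foldr (λ x acc → f x * acc) 1# xs

  pow : Carrier → ℕ → Carrier
  pow x zero = 1#
  pow x (suc m) = x * pow x m

-- The parallelepiped data.  V i j = j-th coordinate of the vector V_i.

Basis : ℕ → Set
Basis n = Fin n → Fin n → ℤ

detℤ : ∀ {n} → Basis n → ℤ
detℤ {n} V = Det.det ℤP.+-*-commutativeRing V (allFin n) (allFin n)

LinIndep : ∀ {n} → Basis n → Set
LinIndep V = ¬ (detℤ V ≡ + 0)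

Vol : ∀ {n} → Basis n → ℕ
Vol V = ℤ.∣ detℤ V ∣

sumℚ : ∀ {n} → (Fin n → ℚ) → ℚ
sumℚ {n} f = List.foldr (λ i acc → f i ℚ.+ acc) 0ℚ (allFin n)

IsInt : ℚ → Set
IsInt q = Σ ℤ λ m → q ≡ (m ℚ./ 1)

-- A point of Δ's cone is described by its coordinates z ∈ ℚ^n w.r.t. the
-- basis V_1,…,V_n; the corresponding point of ℝ^n is Σ z_i V_i.
point : ∀ {n} → Basis n → Vec ℚ n → Fin n → ℚ
point {n} V z j = sumℚ (λ i → Vec.lookup z i ℚ.* (V i j ℚ./ 1))

IsLattice : ∀ {n} → Basis n → Vec ℚ n → Set
IsLattice V z = ∀ j → IsInt (point V z j)

InCone : ∀ {n} → Basis n → Vec ℚ n → Set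
InCone V z = IsLattice V z × (∀ i → 0ℚ ℚ.≤ Vec.lookup z i)

DenomOK : ∀ {n} → Basis n → ℕ → Set
DenomOK V D = ∀ z → InCone V z → ∀ i → IsInt ((+ D ℚ./ 1) ℚ.* Vec.lookup z i)

IsD : ∀ {n} → Basis n → ℕ → Set
IsD V D = (0 ℕ.< D) × DenomOK V D × (∀ D' → 0 ℕ.< D' → DenomOK V D' → D ℕ.≤ D')

data PM : Set where
  plus minus : PM

upper : PM → ℚ → ℚ → Set
upper plus  x k = x ℚ.≤ k
upper minus x k = x ℚ.< k

InDelta : ∀ {n} → Basis n → ℕ → PM → Vec ℚ n → Set
InDelta V k s z =
  IsLattice V z × (∀ i → (0ℚ ℚ.≤ Vec.lookup z i) × upper s (Vec.lookup z i) (+ k ℚ./ 1))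

Enumerates : ∀ {n} → (Vec ℚ n → Set) → List (Vec ℚ n) → Set
Enumerates P L = Unique L × (∀ z → (z ∈ L) ⇔ P z)

-- Artin–Hasse exponential E(x) = exp(Σ_{i≥0} x^{p^i}/p^i) = Σ_m λ_m x^m

invℕ : ℕ → ℚ
invℕ zero = 0ℚ
invℕ (suc m) = + 1 ℚ./ suc m

isPowOf : ℕ → ℕ → Bool
isPowOf p j = List.foldr (λ i b → (p ℕ.^ i ≡ᵇ j) ∨ b) false (List.upTo (suc j))

logCoeff : ℕ → ℕ → ℚ
logCoeff p j = if isPowOf p j then invℕ j else 0ℚ

seriesMul : (ℕ → ℚ) → (ℕ → ℚ) → ℕ → ℚ
seriesMul f g m = List.foldr (λ i acc → f i ℚ.* g (m ∸ i) ℚ.+ acc) 0ℚ (List.upTo (suc m))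

seriesPow : (ℕ → ℚ) → ℕ → ℕ → ℚ
seriesPow f zero m = if m ≡ᵇ 0 then 1ℚ else 0ℚ
seriesPow f (suc j) = seriesMul f (seriesPow f j)

-- λ_m = coefficient of x^m in exp(f) = Σ_j f^j/j!  (f has no constant term,
-- so only j ≤ m contribute)
ahCoeff : ℕ → ℕ → ℚ
ahCoeff p m =
  List.foldr (λ j acc → seriesPow (logCoeff p) j m ℚ.* invℕ (j !) ℚ.+ acc) 0ℚ (List.upTo (suc m))

allᵇ : {A : Set} → (A → Bool) → List A → Bool
allᵇ f = List.foldr (λ x b → f x ∧ b) true

allSubsets : ∀ n → List (Subset n)
allSubsets zero = [] ∷ []
allSubsets (suc n) =
  List.map (inside ∷_) (allSubsets n) ++ List.map (outside ∷_) (allSubsets n)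

isEmpty : ∀ {n} → Subset n → Bool
isEmpty [] = true
isEmpty (inside ∷ s) = false
isEmpty (outside ∷ s) = isEmpty s

nonemptySubsets : ∀ n → List (Subset n)
nonemptySubsets n = filterᵇ (λ S → not (isEmpty S)) (allSubsets n)

mem : ∀ {n} → Fin n → Subset n → Bool
mem i S with Vec.lookup S i
... | inside = true
... | outside = false

subsetᵇ : ∀ {n} → Subset n → Subset n → Bool
subsetᵇ {n} I J = allᵇ (λ i → not (mem i I) ∨ mem i J) (allFin n)

module Alg (R : CommutativeRing 0ℓ 0ℓ) (ι : ℚ → CommutativeRing.Carrier R) where
  open CommutativeRing R
  open Det R

  -- max m with w - m·1_S ≥ 0  (for S nonempty: min_{i∈S} w_i)
  maxMult : ∀ {n} → Subset n → Vec ℕ n → ℕ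
  maxMult {n} S w =
    List.foldr (λ i b → if mem i S then ℕ._⊓_ (Vec.lookup w i) b else b)
               (Vec.foldr′ ℕ._+_ 0 w) (allFin n)

  subMult : ∀ {n} → Subset n → ℕ → Vec ℕ n → Vec ℕ n
  subMult [] m [] = []
  subMult (inside ∷ S) m (x ∷ w) = (x ∸ m) ∷ subMult S m w
  subMult (outside ∷ S) m (x ∷ w) = x ∷ subMult S m w

  isZeroVec : ∀ {n} → Vec ℕ n → Bool
  isZeroVec w = Vec.foldr′ _∧_ true (Vec.map (λ x → x ≡ᵇ 0) w)

  -- coefficient of x^{Σ w_i V_i} in Π_{S ∈ Ss} E(a_{#S} π x^{V_S})
  coeffProd : ∀ {n} → ℕ → Carrier → (ℕ → Carrier) → List (Subset n) → Vec ℕ n → Carrier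
  coeffProd p π a [] w = if isZeroVec w then 1# else 0#
  coeffProd p π a (S ∷ Ss) w =
    sumL (λ m → ι (ahCoeff p m) * pow (a ∣ S ∣ * π) m * coeffProd p π a Ss (subMult S m w))
         (List.upTo (suc (maxMult S w)))

  toℕ? : ℚ → Maybe ℕ
  toℕ? q with ℚ.↥ q | ℚ.↧ₙ q
  ... | + x | 1 = just x
  ... | _ | _ = nothing

  toℕVec? : ∀ {n} → Vec ℚ n → Maybe (Vec ℕ n)
  toℕVec? [] = just []
  toℕVec? (q ∷ qs) with toℕ? q | toℕVec? qs
  ... | just x | just xs = just (x ∷ xs)
  ... | _ | _ = nothing

  -- ẽ^res_Q for Q = Σ w_i V_i (zero if x^Q does not occur)
  eres : ∀ {n} → ℕ → Carrier → (ℕ → Carrier) → Vec ℚ n → Carrier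
  eres {n} p π a w with toℕVec? w
  ... | just w' = coeffProd p π a (nonemptySubsets n) w'
  ... | nothing = 0#

  _⊕_ _⊖_ : ∀ {n} → Vec ℚ n → Vec ℚ n → Vec ℚ n
  u ⊕ v = Vec.zipWith ℚ._+_ u v
  u ⊖ v = Vec.zipWith ℚ._-_ u v

  scale : ∀ {n} → ℕ → Vec ℚ n → Vec ℚ n
  scale p = Vec.map ((+ p ℚ./ 1) ℚ.*_)

  frac : ℚ → ℚ
  frac q = q ℚ.- (ℚ.floor q ℚ./ 1)

  -- η(Q): the element of Δ^- congruent to pQ mod ⊕ ℤV_i
  η : ∀ {n} → ℕ → Vec ℚ n → Vec ℚ n
  η p z = Vec.map (λ x → frac ((+ p ℚ./ 1) ℚ.* x)) z

  isIntᵇ : ℚ → Bool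
  isIntᵇ q = ℚ.↧ₙ q ≡ᵇ 1

  eqᵇ ltᵇ : ℚ → ℚ → Bool
  eqᵇ x y = does (x ℚ.≟ y)
  ltᵇ x y = does (x ℚ.<? y)

  inIP0 : ∀ {n} → Vec ℚ n → Subset n → Bool
  inIP0 {n} r I = allᵇ (λ i → not (mem i I) ∨ eqᵇ (Vec.lookup r i) 0ℚ) (allFin n)

  -- membership in Δ_k^±(I,P0), given membership in Δ_k^±
  inIP : ∀ {n} → Subset n → Vec ℚ n → Vec ℚ n → Bool
  inIP {n} I r z =
    allᵇ (λ i → if mem i I then eqᵇ (Vec.lookup z i) 0ℚ
                               else ltᵇ 0ℚ (Vec.lookup z i)) (allFin n)
    ∧ allᵇ (λ i → isIntᵇ (Vec.lookup z i ℚ.- Vec.lookup r i)) (allFin n)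

  -- left side: det(ẽ^res_{pQ-Q'})_{Q,Q' ∈ Δ_k^±}, Lk enumerating Δ_k^±
  lhs : ∀ {n} → ℕ → Carrier → (ℕ → Carrier) → List (Vec ℚ n) → Carrier
  lhs p π a Lk = det (λ z z' → eres p π a (scale p z ⊖ z')) Lk Lk

  -- right side, L1 enumerating Δ^-
  rhs : ∀ {n} → ℕ → Carrier → (ℕ → Carrier) → List (Vec ℚ n) → List (Vec ℚ n) → Carrier
  rhs {n} p π a Lk L1 =
    prodL (λ r →
      prodL (λ I →
        let L = filterᵇ (inIP I r) Lk in
        det (λ z z' → eres p π a ((r ⊖ η p r) ⊕ (scale p z ⊖ z'))) L L)
        (filterᵇ (inIP0 r) (allSubsets n)))
      L1

QAlgebraHom : (R : CommutativeRing 0ℓ 0ℓ) → (ℚ → CommutativeRing.Carrier R) → Set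
QAlgebraHom R ι =
  RingMorphisms.IsRingHomomorphism
    (CommutativeRing.rawRing ℚP.+-*-commutativeRing) (CommutativeRing.rawRing R) ι

-- Group Δ_k^± into residue classes modulo ⊕ ℤ V_i.  Since ẽ^res_{pQ−Q′} = 0 unless pQ − Q′ has natural
-- coordinates, the entry vanishes when Q lies in the class of P₀ ∈ Δ^- and Q′ outside the class of η(P₀).
-- As p is prime to D, η is injective on Δ^- and keeps the zero coordinates of P₀, so up to a column
-- permutation the matrix is block-diagonal with one block per P₀.  Translating the columns of that block
-- by P₀ − η(P₀) gives the matrix (ẽ^res_{P₀−η(P₀)+pQ−Q′}) on the class of P₀, whose entry vanishes when Q
-- has a zero coordinate where Q′ has not; ordering the class by zero sets makes it block-triangular,
-- the diagonal blocks being the Δ_k^±(I, P₀) with I ⊆ I(P₀).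

module Submission where

open import Defs
open import Level using (0ℓ)
open import Data.Nat using (ℕ; _<_; _≤_)
open import Data.Nat.Divisibility using (_∣_)
open import Data.Nat.Primality using (Prime)
open import Data.Rational using (ℚ)
open import Data.Vec using (Vec)
open import Data.List using (List)
open import Data.Sum using (_⊎_)
open import Relation.Nullary using (¬_)
open import Algebra.Bundles using (CommutativeRing)

open import Data.Bool using (Bool; true; false; not; _∧_; _∨_; if_then_else_; T?)
import Data.Bool.Properties as BoolP
import Data.Nat as ℕ
import Data.Nat.Properties as ℕP
import Data.Nat.Coprimality as Coprime
import Data.Nat.GCD as GCD
open import Data.Integer as ℤ using (ℤ; +_; -[1+_]; +[1+_])
import Data.Integer.Properties as ℤP
import Data.Integer.DivMod as ℤDivMod
open import Data.Rational as ℚ using (mkℚ; 0ℚ; 1ℚ)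
import Data.Rational.Properties as ℚP
open import Data.Rational.Solver using (module +-*-Solver)
open import Data.Fin as Fin using (Fin)
open import Data.Fin.Subset using (Subset)
open import Data.Vec as Vec using ([]; _∷_)
import Data.Vec.Properties as VecP
open import Data.List as List using ([]; _∷_; _++_; length; filterᵇ; map; allFin)
import Data.List.Properties as ListP
open import Data.List.Membership.Propositional using (_∈_)
open import Data.List.Membership.Propositional.Properties
  using (∈-++⁺ˡ; ∈-++⁺ʳ; ∈-++⁻; ∈-filter⁺; ∈-filter⁻; ∈-allFin; ∈-map⁺; ∈-map⁻)
open import Data.List.Membership.Propositional.Properties.WithK using (unique∧set⇒bag)
open import Data.List.Relation.Unary.Any using (here; there)
import Data.List.Relation.Unary.All as All
open import Data.List.Relation.Unary.AllPairs as AllPairs using (AllPairs)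
open import Data.List.Relation.Unary.Unique.Propositional using (Unique)
import Data.List.Relation.Unary.Unique.Propositional.Properties as UniqueP
open import Data.List.Relation.Binary.Permutation.Propositional as Perm using (_↭_; ↭-sym)
open import Data.List.Relation.Binary.Permutation.Propositional.Properties using (↭-length; shift)
open import Data.List.Relation.Binary.BagAndSetEquality using (∼bag⇒↭)
open import Data.Maybe using (just; nothing)
open import Data.Product using (Σ; _×_; _,_; proj₁; proj₂)
open import Data.Sum using (inj₁; inj₂)
open import Data.Empty using (⊥-elim)
open import Function using (_∘_)
open import Function.Bundles using (Equivalence; mk⇔)
open import Relation.Nullary using (does; yes; no)
open import Relation.Nullary.Decidable using (dec-true; dec-false)
open import Relation.Binary.PropositionalEquality as ≡
  using (_≡_; _≢_; refl; cong; cong₂; subst; subst₂; module ≡-Reasoning)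
import Algebra.Properties.Ring as RingProperties
import Algebra.Properties.CommutativeSemigroup as CommutativeSemigroupProperties
import Algebra.Solver.CommutativeMonoid as CommutativeMonoidSolver

⟦_⟧ : ℤ → ℚ
⟦ m ⟧ = m ℚ./ 1

⟦⟧≡mkℚ : ∀ m → ⟦ m ⟧ ≡ mkℚ m 0 (Coprime.sym (Coprime.1-coprimeTo ℤ.∣ m ∣))
⟦⟧≡mkℚ m = ℚP.↥p/↧p≡p (mkℚ m 0 (Coprime.sym (Coprime.1-coprimeTo ℤ.∣ m ∣)))

⟦⟧-+ : ∀ a b → ⟦ a ℤ.+ b ⟧ ≡ ⟦ a ⟧ ℚ.+ ⟦ b ⟧
⟦⟧-+ a b = ≡.sym (≡.trans (cong₂ ℚ._+_ (⟦⟧≡mkℚ a) (⟦⟧≡mkℚ b))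
  (cong ⟦_⟧ (cong₂ ℤ._+_ (ℤP.*-identityʳ a) (ℤP.*-identityʳ b))))

⟦⟧-* : ∀ a b → ⟦ a ℤ.* b ⟧ ≡ ⟦ a ⟧ ℚ.* ⟦ b ⟧
⟦⟧-* a b = ≡.sym (cong₂ ℚ._*_ (⟦⟧≡mkℚ a) (⟦⟧≡mkℚ b))

⟦⟧-neg : ∀ a → ⟦ ℤ.- a ⟧ ≡ ℚ.- ⟦ a ⟧
⟦⟧-neg a = ≡.trans (⟦⟧≡mkℚ (ℤ.- a)) (≡.trans (mkℚ-neg a) (cong ℚ.-_ (≡.sym (⟦⟧≡mkℚ a))))
  where
  mkℚ-neg : ∀ a → mkℚ (ℤ.- a) 0 (Coprime.sym (Coprime.1-coprimeTo ℤ.∣ ℤ.- a ∣))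
                ≡ ℚ.- mkℚ a 0 (Coprime.sym (Coprime.1-coprimeTo ℤ.∣ a ∣))
  mkℚ-neg (+ 0)    = refl
  mkℚ-neg +[1+ _ ] = refl
  mkℚ-neg -[1+ _ ] = refl

⟦⟧-mono-≤ : ∀ {a b} → a ℤ.≤ b → ⟦ a ⟧ ℚ.≤ ⟦ b ⟧
⟦⟧-mono-≤ {a} {b} a≤b = subst₂ ℚ._≤_ (≡.sym (⟦⟧≡mkℚ a)) (≡.sym (⟦⟧≡mkℚ b))
  (ℚ.*≤* (subst₂ ℤ._≤_ (≡.sym (ℤP.*-identityʳ a)) (≡.sym (ℤP.*-identityʳ b)) a≤b))

⟦⟧-cancel-< : ∀ {a b} → ⟦ a ⟧ ℚ.< ⟦ b ⟧ → a ℤ.< b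
⟦⟧-cancel-< {a} {b} a<b =
  subst₂ ℤ._<_ (ℤP.*-identityʳ a) (ℤP.*-identityʳ b)
    (ℚP.drop-*<* (subst₂ ℚ._<_ (⟦⟧≡mkℚ a) (⟦⟧≡mkℚ b) a<b))

IsInt-+ : ∀ {x y} → IsInt x → IsInt y → IsInt (x ℚ.+ y)
IsInt-+ (a , refl) (b , refl) = a ℤ.+ b , ≡.sym (⟦⟧-+ a b)

IsInt-neg : ∀ {x} → IsInt x → IsInt (ℚ.- x)
IsInt-neg (a , refl) = ℤ.- a , ≡.sym (⟦⟧-neg a)

IsInt-diff : ∀ {x y} → IsInt x → IsInt y → IsInt (x ℚ.- y)
IsInt-diff x∈ℤ y∈ℤ = IsInt-+ x∈ℤ (IsInt-neg y∈ℤ)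

IsInt-* : ∀ {x y} → IsInt x → IsInt y → IsInt (x ℚ.* y)
IsInt-* (a , refl) (b , refl) = a ℤ.* b , ≡.sym (⟦⟧-* a b)

IsInt-⟦⟧ : ∀ m → IsInt ⟦ m ⟧
IsInt-⟦⟧ m = m , refl

IsInt-resp-≡ : ∀ {x y} → x ≡ y → IsInt x → IsInt y
IsInt-resp-≡ refl x∈ℤ = x∈ℤ

isIntᵇ : ℚ → Bool
isIntᵇ q = ℚ.↧ₙ q ℕ.≡ᵇ 1

isIntᵇ⇒IsInt : ∀ q → isIntᵇ q ≡ true → IsInt q
isIntᵇ⇒IsInt (mkℚ m 0 _) _ = m , ≡.sym (⟦⟧≡mkℚ m)

IsInt⇒isIntᵇ : ∀ q → IsInt q → isIntᵇ q ≡ true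
IsInt⇒isIntᵇ q (m , refl) rewrite ⟦⟧≡mkℚ m = refl

open +-*-Solver using (solve; _:=_; _:+_; _:*_; :-_; _:-_; con)

floor≤ : ∀ q → ⟦ ℚ.floor q ⟧ ℚ.≤ q
floor≤ q@(mkℚ m d _) = subst (ℚ._≤ q) (≡.sym (⟦⟧≡mkℚ (ℚ.floor q)))
  (ℚ.*≤* (subst ((m ℤDivMod./ + ℕ.suc d) ℤ.* + ℕ.suc d ℤ.≤_) (≡.sym (ℤP.*-identityʳ m))
    (ℤDivMod.[n/d]*d≤n m (+ ℕ.suc d))))

<floor+1 : ∀ q → q ℚ.< ⟦ ℚ.floor q ℤ.+ + 1 ⟧
<floor+1 q@(mkℚ m d _) = subst (q ℚ.<_) (≡.sym (⟦⟧≡mkℚ (f ℤ.+ + 1)))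
  (ℚ.*<* (subst (ℤ._< (f ℤ.+ + 1) ℤ.* d′) (≡.sym (ℤP.*-identityʳ m)) m<[f+1]d))
  where
  d′ f : ℤ
  d′ = + ℕ.suc d
  f = m ℤDivMod./ d′
  m<[f+1]d : m ℤ.< (f ℤ.+ + 1) ℤ.* d′
  m<[f+1]d = begin-strict
    m                              ≡⟨ ℤDivMod.a≡a%n+[a/n]*n m d′ ⟩
    + (m ℤDivMod.% d′) ℤ.+ f ℤ.* d′ <⟨ ℤP.+-monoˡ-< (f ℤ.* d′) (ℤ.+<+ (ℤDivMod.n%d<d m d′)) ⟩
    d′ ℤ.+ f ℤ.* d′                ≡⟨ ℤP.+-comm d′ (f ℤ.* d′) ⟩
    f ℤ.* d′ ℤ.+ d′                ≡⟨ cong (λ t → f ℤ.* d′ ℤ.+ t) (≡.sym (ℤP.*-identityˡ d′)) ⟩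
    f ℤ.* d′ ℤ.+ + 1 ℤ.* d′        ≡⟨ ≡.sym (ℤP.*-distribʳ-+ d′ f (+ 1)) ⟩
    (f ℤ.+ + 1) ℤ.* d′             ∎
    where open ℤP.≤-Reasoning

frac : ℚ → ℚ
frac q = q ℚ.- ⟦ ℚ.floor q ⟧

frac-nonneg : ∀ q → 0ℚ ℚ.≤ frac q
frac-nonneg q = subst (ℚ._≤ frac q) (ℚP.+-inverseʳ ⟦ ℚ.floor q ⟧)
  (ℚP.+-monoˡ-≤ (ℚ.- ⟦ ℚ.floor q ⟧) (floor≤ q))

frac<1 : ∀ q → frac q ℚ.< 1ℚ
frac<1 q = subst (frac q ℚ.<_) [f+1]-f≡1 (ℚP.+-monoˡ-< (ℚ.- ⟦ ℚ.floor q ⟧) (<floor+1 q))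
  where
  [f+1]-f≡1 : ⟦ ℚ.floor q ℤ.+ + 1 ⟧ ℚ.- ⟦ ℚ.floor q ⟧ ≡ 1ℚ
  [f+1]-f≡1 = ≡.trans (cong (ℚ._- ⟦ ℚ.floor q ⟧) (⟦⟧-+ (ℚ.floor q) (+ 1)))
    (solve 1 (λ f → (f :+ con 1ℚ) :- f := con 1ℚ) refl ⟦ ℚ.floor q ⟧)

IsInt-sub-frac : ∀ q → IsInt (q ℚ.- frac q)
IsInt-sub-frac q = IsInt-resp-≡ (≡.sym (solve 2 (λ x f → x :- (x :- f) := f) refl q ⟦ ℚ.floor q ⟧))
  (IsInt-⟦⟧ (ℚ.floor q))

-1<m<1⇒m≡0 : ∀ m → -[1+ 0 ] ℤ.< m → m ℤ.< + 1 → m ≡ + 0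
-1<m<1⇒m≡0 (+ 0)          _            _                      = refl
-1<m<1⇒m≡0 +[1+ _ ]       _            (ℤ.+<+ (ℕ.s≤s ()))
-1<m<1⇒m≡0 -[1+ 0 ]       (ℤ.-<- ())   _
-1<m<1⇒m≡0 -[1+ ℕ.suc _ ] (ℤ.-<- ())   _

InUnitInterval : ℚ → Set
InUnitInterval x = (0ℚ ℚ.≤ x) × (x ℚ.< 1ℚ)

frac-inUnitInterval : ∀ q → InUnitInterval (frac q)
frac-inUnitInterval q = frac-nonneg q , frac<1 q

IsInt-diff⇒≡ : ∀ {x y} → InUnitInterval x → InUnitInterval y → IsInt (x ℚ.- y) → x ≡ y
IsInt-diff⇒≡ {x} {y} (0≤x , x<1) (0≤y , y<1) (m , x-y≡m) = begin
  x                  ≡⟨ solve 2 (λ x y → x := (x :- y) :+ y) refl x y ⟩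
  (x ℚ.- y) ℚ.+ y    ≡⟨ cong (ℚ._+ y) (≡.trans x-y≡m (cong ⟦_⟧ m≡0)) ⟩
  0ℚ ℚ.+ y           ≡⟨ ℚP.+-identityˡ y ⟩
  y                  ∎
  where
  open ≡-Reasoning
  x-y<1 : x ℚ.- y ℚ.< 1ℚ
  x-y<1 = subst (x ℚ.- y ℚ.<_) (ℚP.+-identityʳ 1ℚ) (ℚP.+-mono-<-≤ x<1 (ℚP.neg-antimono-≤ 0≤y))
  -1<x-y : ℚ.- 1ℚ ℚ.< x ℚ.- y
  -1<x-y = subst (ℚ._< x ℚ.- y) (ℚP.+-identityˡ (ℚ.- 1ℚ)) (ℚP.+-mono-≤-< 0≤x (ℚP.neg-antimono-< y<1))
  m≡0 : m ≡ + 0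
  m≡0 = -1<m<1⇒m≡0 m (⟦⟧-cancel-< (subst (⟦ -[1+ 0 ] ⟧ ℚ.<_) x-y≡m -1<x-y))
                          (⟦⟧-cancel-< (subst (ℚ._< ⟦ + 1 ⟧) x-y≡m x-y<1))

IsInt⇒≡0 : ∀ {x} → InUnitInterval x → IsInt x → x ≡ 0ℚ
IsInt⇒≡0 {x} x∈I x∈ℤ =
  IsInt-diff⇒≡ x∈I (ℚP.≤-refl , ℚP.positive⁻¹ 1ℚ) (IsInt-resp-≡ (≡.sym (ℚP.+-identityʳ x)) x∈ℤ)

IsInt-from-Bézout : ∀ {x} p d a b → 1 ℕ.+ b ℕ.* d ≡ a ℕ.* p →
                    IsInt (⟦ + p ⟧ ℚ.* x) → IsInt (⟦ + d ⟧ ℚ.* x) → IsInt x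
IsInt-from-Bézout {x} p d a b eq px∈ℤ dx∈ℤ =
  IsInt-resp-≡ (≡.sym x≡a[px]-b[dx]) (IsInt-diff (IsInt-* (IsInt-⟦⟧ (+ a)) px∈ℤ) (IsInt-* (IsInt-⟦⟧ (+ b)) dx∈ℤ))
  where
  open ≡-Reasoning
  eqℚ : 1ℚ ℚ.+ ⟦ + b ⟧ ℚ.* ⟦ + d ⟧ ≡ ⟦ + a ⟧ ℚ.* ⟦ + p ⟧
  eqℚ = begin
    1ℚ ℚ.+ ⟦ + b ⟧ ℚ.* ⟦ + d ⟧  ≡⟨ ≡.sym (≡.trans (⟦⟧-+ (+ 1) (+ b ℤ.* + d)) (cong (1ℚ ℚ.+_) (⟦⟧-* (+ b) (+ d)))) ⟩
    ⟦ + 1 ℤ.+ + b ℤ.* + d ⟧     ≡⟨ cong ⟦_⟧ (≡.trans (cong (ℤ._+_ (+ 1)) (≡.sym (ℤP.pos-* b d))) (cong +_ eq)) ⟩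
    ⟦ + (a ℕ.* p) ⟧             ≡⟨ cong ⟦_⟧ (ℤP.pos-* a p) ⟩
    ⟦ + a ℤ.* + p ⟧             ≡⟨ ⟦⟧-* (+ a) (+ p) ⟩
    ⟦ + a ⟧ ℚ.* ⟦ + p ⟧         ∎
  x≡a[px]-b[dx] : x ≡ ⟦ + a ⟧ ℚ.* (⟦ + p ⟧ ℚ.* x) ℚ.- ⟦ + b ⟧ ℚ.* (⟦ + d ⟧ ℚ.* x)
  x≡a[px]-b[dx] = begin
    x  ≡⟨ solve 3 (λ x b d → x := (con 1ℚ :+ b :* d) :* x :- b :* (d :* x)) refl x ⟦ + b ⟧ ⟦ + d ⟧ ⟩
    (1ℚ ℚ.+ ⟦ + b ⟧ ℚ.* ⟦ + d ⟧) ℚ.* x ℚ.- ⟦ + b ⟧ ℚ.* (⟦ + d ⟧ ℚ.* x)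
       ≡⟨ cong (λ t → t ℚ.* x ℚ.- ⟦ + b ⟧ ℚ.* (⟦ + d ⟧ ℚ.* x)) eqℚ ⟩
    (⟦ + a ⟧ ℚ.* ⟦ + p ⟧) ℚ.* x ℚ.- ⟦ + b ⟧ ℚ.* (⟦ + d ⟧ ℚ.* x)
       ≡⟨ cong (ℚ._- ⟦ + b ⟧ ℚ.* (⟦ + d ⟧ ℚ.* x)) (ℚP.*-assoc ⟦ + a ⟧ ⟦ + p ⟧ x) ⟩
    ⟦ + a ⟧ ℚ.* (⟦ + p ⟧ ℚ.* x) ℚ.- ⟦ + b ⟧ ℚ.* (⟦ + d ⟧ ℚ.* x) ∎

IsInt-from-coprime-multiples : ∀ {x p d} → Coprime.Coprime p d →
  IsInt (⟦ + p ⟧ ℚ.* x) → IsInt (⟦ + d ⟧ ℚ.* x) → IsInt x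
IsInt-from-coprime-multiples {p = p} {d} p⊥d px∈ℤ dx∈ℤ with Coprime.coprime-Bézout p⊥d
... | GCD.Bézout.+- a b eq = IsInt-from-Bézout p d a b eq px∈ℤ dx∈ℤ
... | GCD.Bézout.-+ a b eq = IsInt-from-Bézout d p b a eq dx∈ℤ px∈ℤ

InRange : PM → ℕ → ℚ → Set
InRange s k t = (0ℚ ℚ.≤ t) × upper s t ⟦ + k ⟧

InRange-transfer : ∀ s k {x y} m → 0ℚ ℚ.< x → x ℚ.< 1ℚ → 0ℚ ℚ.< y → y ℚ.< 1ℚ →
                   InRange s k (x ℚ.+ ⟦ m ⟧) → InRange s k (y ℚ.+ ⟦ m ⟧)
InRange-transfer s k {x} {y} m 0<x x<1 0<y y<1 (0≤x+m , x+m≤k) = 0≤y+m , y+m≤k s x+m≤k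
  where
  0≤m : 0ℚ ℚ.≤ ⟦ m ⟧
  0≤m = ⟦⟧-mono-≤ (ℤP.i<j⇒suc[i]≤j (⟦⟧-cancel-< { -[1+ 0 ]} {m}
    (subst₂ ℚ._<_ (ℚP.+-identityʳ (ℚ.- 1ℚ)) (solve 2 (λ x m → (:- x) :+ (x :+ m) := m) refl x ⟦ m ⟧)
      (ℚP.+-mono-<-≤ (ℚP.neg-antimono-< x<1) 0≤x+m))))
  0≤y+m : 0ℚ ℚ.≤ y ℚ.+ ⟦ m ⟧
  0≤y+m = subst (ℚ._≤ y ℚ.+ ⟦ m ⟧) (ℚP.+-identityʳ 0ℚ) (ℚP.+-mono-≤ (ℚP.<⇒≤ 0<y) 0≤m)
  m<x+m : ⟦ m ⟧ ℚ.< x ℚ.+ ⟦ m ⟧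
  m<x+m = subst (ℚ._< x ℚ.+ ⟦ m ⟧) (ℚP.+-identityˡ ⟦ m ⟧) (ℚP.+-monoˡ-< ⟦ m ⟧ 0<x)
  m<k : ∀ s → upper s (x ℚ.+ ⟦ m ⟧) ⟦ + k ⟧ → ⟦ m ⟧ ℚ.< ⟦ + k ⟧
  m<k plus  x+m≤k = ℚP.<-≤-trans m<x+m x+m≤k
  m<k minus x+m<k = ℚP.<-trans m<x+m x+m<k
  y+m<k : ∀ s → upper s (x ℚ.+ ⟦ m ⟧) ⟦ + k ⟧ → y ℚ.+ ⟦ m ⟧ ℚ.< ⟦ + k ⟧
  y+m<k s x+m≤k = ℚP.<-≤-trans (ℚP.+-monoˡ-< ⟦ m ⟧ y<1)
    (subst (ℚ._≤ ⟦ + k ⟧) (⟦⟧-+ (+ 1) m)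
      (⟦⟧-mono-≤ {+ 1 ℤ.+ m} {+ k} (ℤP.i<j⇒suc[i]≤j (⟦⟧-cancel-< {m} {+ k} (m<k s x+m≤k)))))
  y+m≤k : ∀ s → upper s (x ℚ.+ ⟦ m ⟧) ⟦ + k ⟧ → upper s (y ℚ.+ ⟦ m ⟧) ⟦ + k ⟧
  y+m≤k plus  x+m≤k = ℚP.<⇒≤ (y+m<k plus x+m≤k)
  y+m≤k minus x+m<k = y+m<k minus x+m<k

≢0⇒0< : ∀ {x} → 0ℚ ℚ.≤ x → x ≢ 0ℚ → 0ℚ ℚ.< x
≢0⇒0< 0≤x x≢0 = ℚP.≰⇒> (λ x≤0 → x≢0 (ℚP.≤-antisym x≤0 0≤x))

isZeroᵇ : ℚ → Bool
isZeroᵇ x = does (x ℚ.≟ 0ℚ)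

isPositiveᵇ : ℚ → Bool
isPositiveᵇ x = does (0ℚ ℚ.<? x)

isZeroᵇ⇒≡0 : ∀ {x} → isZeroᵇ x ≡ true → x ≡ 0ℚ
isZeroᵇ⇒≡0 {x} _ with x ℚ.≟ 0ℚ
... | yes x≡0 = x≡0

≡0⇒isZeroᵇ : ∀ {x} → x ≡ 0ℚ → isZeroᵇ x ≡ true
≡0⇒isZeroᵇ {x} = dec-true (x ℚ.≟ 0ℚ)

isZeroᵇ-false⇒≢0 : ∀ {x} → isZeroᵇ x ≡ false → x ≢ 0ℚ
isZeroᵇ-false⇒≢0 x≢0 x≡0 with () ← ≡.trans (≡.sym (≡0⇒isZeroᵇ x≡0)) x≢0

isPositiveᵇ≡not-isZeroᵇ : ∀ {x} → 0ℚ ℚ.≤ x → isPositiveᵇ x ≡ not (isZeroᵇ x)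
isPositiveᵇ≡not-isZeroᵇ {x} 0≤x with x ℚ.≟ 0ℚ
... | yes refl = dec-false (0ℚ ℚ.<? 0ℚ) (ℚP.<-irrefl refl)
... | no  x≢0  = dec-true (0ℚ ℚ.<? x) (≢0⇒0< 0≤x x≢0)

module _ {A : Set} where

  ∈-filterᵇ⁻ : (P : A → Bool) {x : A} (xs : List A) → x ∈ filterᵇ P xs → x ∈ xs × P x ≡ true
  ∈-filterᵇ⁻ P xs x∈ with ∈-filter⁻ (T? ∘ P) {xs = xs} x∈
  ... | x∈xs , Px = x∈xs , Equivalence.to BoolP.T-≡ Px

  ∈-filterᵇ⁺ : (P : A → Bool) {x : A} (xs : List A) → x ∈ xs → P x ≡ true → x ∈ filterᵇ P xs
  ∈-filterᵇ⁺ P xs x∈xs Px = ∈-filter⁺ (T? ∘ P) x∈xs (Equivalence.from BoolP.T-≡ Px)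

  filterᵇ-partition-↭ : (P : A → Bool) (xs : List A) → xs ↭ filterᵇ P xs ++ filterᵇ (not ∘ P) xs
  filterᵇ-partition-↭ P [] = Perm.refl
  filterᵇ-partition-↭ P (x ∷ xs) with P x
  ... | true  = Perm.prep x (filterᵇ-partition-↭ P xs)
  ... | false = Perm.trans (Perm.prep x (filterᵇ-partition-↭ P xs))
                  (↭-sym (shift x (filterᵇ P xs) (filterᵇ (not ∘ P) xs)))

  length-filterᵇ-partition : (P : A → Bool) (xs : List A) →
    length (filterᵇ P xs) ℕ.+ length (filterᵇ (not ∘ P) xs) ≡ length xs
  length-filterᵇ-partition P xs =
    ≡.trans (≡.sym (ListP.length-++ (filterᵇ P xs))) (≡.sym (↭-length (filterᵇ-partition-↭ P xs)))

  filterᵇ-cong : (P Q : A → Bool) (xs : List A) → (∀ x → x ∈ xs → P x ≡ Q x) → filterᵇ P xs ≡ filterᵇ Q xs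
  filterᵇ-cong P Q [] _ = refl
  filterᵇ-cong P Q (x ∷ xs) P≡Q with P x in Px | Q x in Qx | P≡Q x (here refl)
  ... | true  | true  | _ = cong (x ∷_) (filterᵇ-cong P Q xs (λ y y∈ → P≡Q y (there y∈)))
  ... | false | false | _ = filterᵇ-cong P Q xs (λ y y∈ → P≡Q y (there y∈))

  filterᵇ-filterᵇ : (P Q : A → Bool) (xs : List A) → filterᵇ P (filterᵇ Q xs) ≡ filterᵇ (λ x → Q x ∧ P x) xs
  filterᵇ-filterᵇ P Q [] = refl
  filterᵇ-filterᵇ P Q (x ∷ xs) with Q x
  ... | false = filterᵇ-filterᵇ P Q xs
  ... | true with P x
  ...   | true  = cong (x ∷_) (filterᵇ-filterᵇ P Q xs)
  ...   | false = filterᵇ-filterᵇ P Q xs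

  filterᵇ-absorb : (P Q : A → Bool) (xs : List A) → (∀ x → P x ≡ true → Q x ≡ true) →
                   filterᵇ P (filterᵇ Q xs) ≡ filterᵇ P xs
  filterᵇ-absorb P Q xs P⇒Q = ≡.trans (filterᵇ-filterᵇ P Q xs) (filterᵇ-cong _ _ xs (λ x _ → Q∧P≡P x))
    where
    Q∧P≡P : ∀ x → Q x ∧ P x ≡ P x
    Q∧P≡P x with P x in Px
    ... | false = BoolP.∧-zeroʳ (Q x)
    ... | true  = ≡.trans (BoolP.∧-identityʳ (Q x)) (P⇒Q x Px)

  filterᵇ-none : (P : A → Bool) (xs : List A) → (∀ x → x ∈ xs → P x ≡ false) → filterᵇ P xs ≡ []
  filterᵇ-none P [] _ = refl
  filterᵇ-none P (x ∷ xs) ¬P with P x | ¬P x (here refl)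
  ... | false | _ = filterᵇ-none P xs (λ y y∈ → ¬P y (there y∈))

  filterᵇ-all : (P : A → Bool) (xs : List A) → (∀ x → P x ≡ true) → filterᵇ P xs ≡ xs
  filterᵇ-all P [] _ = refl
  filterᵇ-all P (x ∷ xs) allP with P x | allP x
  ... | true | _ = cong (x ∷_) (filterᵇ-all P xs allP)

  allᵇ-intro : (P : A → Bool) (xs : List A) → (∀ x → x ∈ xs → P x ≡ true) → allᵇ P xs ≡ true
  allᵇ-intro P [] _ = refl
  allᵇ-intro P (x ∷ xs) allP rewrite allP x (here refl) = allᵇ-intro P xs (λ y y∈ → allP y (there y∈))

  allᵇ-elim : (P : A → Bool) (xs : List A) → allᵇ P xs ≡ true → ∀ x → x ∈ xs → P x ≡ true
  allᵇ-elim P (y ∷ ys) all≡true x x∈ with P y in Py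
  allᵇ-elim P (y ∷ ys) all≡true x (here refl) | true = Py
  allᵇ-elim P (y ∷ ys) all≡true x (there x∈) | true = allᵇ-elim P ys all≡true x x∈

  allᵇ-false : (P : A → Bool) (xs : List A) → allᵇ P xs ≡ false → Σ A (λ x → x ∈ xs × P x ≡ false)
  allᵇ-false P (y ∷ ys) all≡false with P y in Py
  ... | true  = let x , x∈ , Px = allᵇ-false P ys all≡false in x , there x∈ , Px
  ... | false = y , here refl , Py

allᵇ-allFin-intro : ∀ {n} (P : Fin n → Bool) → (∀ i → P i ≡ true) → allᵇ P (allFin n) ≡ true
allᵇ-allFin-intro {n} P allP = allᵇ-intro P (allFin n) (λ i _ → allP i)

allᵇ-allFin-elim : ∀ {n} (P : Fin n → Bool) → allᵇ P (allFin n) ≡ true → ∀ i → P i ≡ true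
allᵇ-allFin-elim {n} P all≡true i = allᵇ-elim P (allFin n) all≡true i (∈-allFin i)

Vec-≡ᵇ : ∀ {m} → Vec Bool m → Vec Bool m → Bool
Vec-≡ᵇ []       []       = true
Vec-≡ᵇ (x ∷ xs) (y ∷ ys) = (if x then y else not y) ∧ Vec-≡ᵇ xs ys

allᵇ-cong : {A : Set} (P Q : A → Bool) (xs : List A) → (∀ x → P x ≡ Q x) → allᵇ P xs ≡ allᵇ Q xs
allᵇ-cong P Q []       _   = refl
allᵇ-cong P Q (x ∷ xs) P≗Q = cong₂ _∧_ (P≗Q x) (allᵇ-cong P Q xs P≗Q)

allᵇ-tabulate : ∀ {m} {A : Set} (P : A → Bool) (f : Fin m → A) → allᵇ P (List.tabulate f) ≡ allᵇ (P ∘ f) (allFin m)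
allᵇ-tabulate {0}       P f = refl
allᵇ-tabulate {ℕ.suc m} P f = cong (P (f Fin.zero) ∧_)
  (≡.trans (allᵇ-tabulate P (f ∘ Fin.suc)) (≡.sym (allᵇ-tabulate (P ∘ f) Fin.suc)))

Vec-≡ᵇ-lookup : ∀ {m} (u v : Vec Bool m) →
  Vec-≡ᵇ u v ≡ allᵇ (λ i → if Vec.lookup u i then Vec.lookup v i else not (Vec.lookup v i)) (allFin m)
Vec-≡ᵇ-lookup []       []       = refl
Vec-≡ᵇ-lookup (x ∷ xs) (y ∷ ys) = cong (_ ∧_) (≡.trans (Vec-≡ᵇ-lookup xs ys) (≡.sym (allᵇ-tabulate agree Fin.suc)))
  where
  agree : Fin _ → Bool
  agree i = if Vec.lookup (x ∷ xs) i then Vec.lookup (y ∷ ys) i else not (Vec.lookup (y ∷ ys) i)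

mem≡lookup : ∀ {m} (i : Fin m) (I : Vec Bool m) → mem i I ≡ Vec.lookup I i
mem≡lookup i I with Vec.lookup I i
... | true  = refl
... | false = refl

∧-≡true⁻ : ∀ {a b} → a ∧ b ≡ true → a ≡ true × b ≡ true
∧-≡true⁻ {true} {true} _ = refl , refl

module Signs {c ℓ} (R : CommutativeRing c ℓ) where

  open CommutativeRing R renaming (refl to ≈-refl)
  open Det R
  open RingProperties ring using (-1*x≈-x; -‿distribˡ-*)
  open import Algebra.Properties.Group +-group using () renaming (⁻¹-involutive to -‿involutive)
  open CommutativeSemigroupProperties *-commutativeSemigroup using (interchange)
  open import Relation.Binary.Reasoning.Setoid setoid

  sgn-suc : ∀ m → sgn (ℕ.suc m) ≈ - sgn m
  sgn-suc 0           = ≈-refl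
  sgn-suc (ℕ.suc m) = sym (trans (-‿cong (sgn-suc m)) (-‿involutive (sgn m)))

  sgn-+ : ∀ m n → sgn (m ℕ.+ n) ≈ sgn m * sgn n
  sgn-+ 0           n = sym (*-identityˡ _)
  sgn-+ (ℕ.suc m) n = begin
    sgn (ℕ.suc (m ℕ.+ n))  ≈⟨ sgn-suc (m ℕ.+ n) ⟩
    - sgn (m ℕ.+ n)        ≈⟨ -‿cong (sgn-+ m n) ⟩
    - (sgn m * sgn n)      ≈⟨ -‿distribˡ-* _ _ ⟩
    - sgn m * sgn n        ≈⟨ *-cong (sym (sgn-suc m)) ≈-refl ⟩
    sgn (ℕ.suc m) * sgn n ∎

  sgn-double : ∀ m → sgn (m ℕ.+ m) ≡ 1#
  sgn-double 0           = refl
  sgn-double (ℕ.suc m) rewrite ℕP.+-suc m m = sgn-double m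

  sgn-+-double : ∀ m k → sgn (m ℕ.+ (k ℕ.+ k)) ≈ sgn m
  sgn-+-double m k = trans (sgn-+ m (k ℕ.+ k)) (trans (*-cong ≈-refl (reflexive (sgn-double k))) (*-identityʳ _))

  sgn-square : ∀ m → sgn m * sgn m ≈ 1#
  sgn-square m = trans (sym (sgn-+ m m)) (reflexive (sgn-double m))

  IsSign : Carrier → Set ℓ
  IsSign e = (e ≈ 1#) ⊎ (e ≈ - 1#)

  IsSign-* : ∀ {e d} → IsSign e → IsSign d → IsSign (e * d)
  IsSign-* (inj₁ e≈1)  (inj₁ d≈1)  = inj₁ (trans (*-cong e≈1 d≈1) (*-identityˡ _))
  IsSign-* (inj₁ e≈1)  (inj₂ d≈-1) = inj₂ (trans (*-cong e≈1 d≈-1) (*-identityˡ _))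
  IsSign-* (inj₂ e≈-1) (inj₁ d≈1)  = inj₂ (trans (*-cong e≈-1 d≈1) (*-identityʳ _))
  IsSign-* (inj₂ e≈-1) (inj₂ d≈-1) =
    inj₁ (trans (*-cong e≈-1 d≈-1) (trans (-1*x≈-x (- 1#)) (-‿involutive 1#)))

  IsSign-sgn : ∀ m → IsSign (sgn m)
  IsSign-sgn 0                   = inj₁ ≈-refl
  IsSign-sgn 1                   = inj₂ ≈-refl
  IsSign-sgn (ℕ.suc (ℕ.suc m)) = IsSign-sgn m

  infix 4 _≈±_
  _≈±_ : Carrier → Carrier → Set (c Level.⊔ ℓ)
  x ≈± y = Σ Carrier (λ e → IsSign e × x ≈ e * y)

  ≈⇒≈± : ∀ {x y} → x ≈ y → x ≈± y
  ≈⇒≈± x≈y = 1# , inj₁ ≈-refl , trans x≈y (sym (*-identityˡ _))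

  ≈±-trans : ∀ {x y z} → x ≈± y → y ≈± z → x ≈± z
  ≈±-trans (e , ±e , x≈ey) (d , ±d , y≈dz) =
    e * d , IsSign-* ±e ±d , trans x≈ey (trans (*-cong ≈-refl y≈dz) (sym (*-assoc _ _ _)))

  ≈±-respʳ : ∀ {x y y′} → y ≈ y′ → x ≈± y → x ≈± y′
  ≈±-respʳ y≈y′ (e , ±e , x≈ey) = e , ±e , trans x≈ey (*-cong ≈-refl y≈y′)

  ≈±-* : ∀ {x x′ y y′} → x ≈± x′ → y ≈± y′ → x * y ≈± x′ * y′
  ≈±-* (e , ±e , x≈ex′) (d , ±d , y≈dy′) =
    e * d , IsSign-* ±e ±d , trans (*-cong x≈ex′ y≈dy′) (interchange _ _ _ _)

  ≈±⇒≈⊎≈- : ∀ {x y} → x ≈± y → (x ≈ y) ⊎ (x ≈ - y)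
  ≈±⇒≈⊎≈- (e , inj₁ e≈1  , x≈ey) = inj₁ (trans x≈ey (trans (*-cong e≈1 ≈-refl) (*-identityˡ _)))
  ≈±⇒≈⊎≈- (e , inj₂ e≈-1 , x≈ey) = inj₂ (trans x≈ey (trans (*-cong e≈-1 ≈-refl) (-1*x≈-x _)))

  prodL-cong : ∀ {B : Set} (f g : B → Carrier) xs → (∀ x → x ∈ xs → f x ≈ g x) → prodL f xs ≈ prodL g xs
  prodL-cong f g []       _   = ≈-refl
  prodL-cong f g (x ∷ xs) f≈g = *-cong (f≈g x (here refl)) (prodL-cong f g xs (λ y y∈ → f≈g y (there y∈)))

  prodL-≈± : ∀ {B : Set} (f g : B → Carrier) xs → (∀ x → x ∈ xs → f x ≈± g x) → prodL f xs ≈± prodL g xs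
  prodL-≈± f g []       _    = ≈⇒≈± ≈-refl
  prodL-≈± f g (x ∷ xs) f≈±g = ≈±-* (f≈±g x (here refl)) (prodL-≈± f g xs (λ y y∈ → f≈±g y (there y∈)))

  prodL-++ : ∀ {B : Set} (f : B → Carrier) xs ys → prodL f (xs ++ ys) ≈ prodL f xs * prodL f ys
  prodL-++ f []       ys = sym (*-identityˡ _)
  prodL-++ f (x ∷ xs) ys = trans (*-cong ≈-refl (prodL-++ f xs ys)) (sym (*-assoc _ _ _))

  prodL-map : ∀ {B B′ : Set} (f : B → Carrier) (h : B′ → B) xs → prodL f (map h xs) ≡ prodL (f ∘ h) xs
  prodL-map f h []       = refl
  prodL-map f h (x ∷ xs) = cong (f (h x) *_) (prodL-map f h xs)

  prodL-filterᵇ : ∀ {B : Set} (f : B → Carrier) (P : B → Bool) xs →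
    (∀ x → x ∈ xs → P x ≡ false → f x ≈ 1#) → prodL f (filterᵇ P xs) ≈ prodL f xs
  prodL-filterᵇ f P [] _ = ≈-refl
  prodL-filterᵇ f P (x ∷ xs) f≈1 with P x in Px
  ... | true  = *-cong ≈-refl (prodL-filterᵇ f P xs (λ y y∈ → f≈1 y (there y∈)))
  ... | false = trans (prodL-filterᵇ f P xs (λ y y∈ → f≈1 y (there y∈)))
                  (sym (trans (*-cong (f≈1 x (here refl) Px) ≈-refl) (*-identityˡ _)))

-- Determinants of list-indexed matrices

module Determinant {c ℓ} (R : CommutativeRing c ℓ) {A : Set} where

  open CommutativeRing R renaming (refl to ≈-refl)
  open Det R
  open Signs R
  open CommutativeSemigroupProperties *-commutativeSemigroup using (interchange; x∙yz≈y∙xz)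
  open import Relation.Binary.Reasoning.Setoid setoid

  Matrix : Set c
  Matrix = A → A → Carrier

  -- A summand indexed by a splitting  cs = pre ++ x ∷ post  of the column list.
  Summand : Set c
  Summand = List A → A → List A → Carrier

  laplaceSum : Summand → List A → List A → Carrier
  laplaceSum g pre []         = 0#
  laplaceSum g pre (x ∷ post) = g pre x post + laplaceSum g (pre ++ x ∷ []) post

  cofactor : Matrix → A → List A → Summand
  cofactor M r rs pre x post = sgn (length pre) * M r x * det M rs (pre ++ post)

  det-∷ : ∀ M r rs cs → det M (r ∷ rs) cs ≡ laplaceSum (cofactor M r rs) [] cs
  det-∷ M r rs = expand≡ []
    where
    expand≡ : ∀ pre post → expand M r rs pre post ≡ laplaceSum (cofactor M r rs) pre post
    expand≡ pre []         = refl
    expand≡ pre (x ∷ post) = cong (_+_ (cofactor M r rs pre x post)) (expand≡ (pre ++ x ∷ []) post)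

  laplaceSum-ext : ∀ g h → (∀ a x b → g a x b ≡ h a x b) → ∀ pre post → laplaceSum g pre post ≡ laplaceSum h pre post
  laplaceSum-ext g h g≡h pre []         = refl
  laplaceSum-ext g h g≡h pre (x ∷ post) = cong₂ _+_ (g≡h pre x post) (laplaceSum-ext g h g≡h (pre ++ x ∷ []) post)

  laplaceSum-shift : ∀ g pre q post → laplaceSum g (pre ++ q) post ≡ laplaceSum (λ a → g (pre ++ a)) q post
  laplaceSum-shift g pre q []         = refl
  laplaceSum-shift g pre q (x ∷ post) = cong (_+_ (g (pre ++ q) x post))
    (≡.trans (cong (λ l → laplaceSum g l post) (ListP.++-assoc pre q (x ∷ [])))
             (laplaceSum-shift g pre (q ++ x ∷ []) post))

  laplaceSum-∷ : ∀ g x post → laplaceSum g [] (x ∷ post) ≡ g [] x post + laplaceSum (λ a → g (x ∷ a)) [] post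
  laplaceSum-∷ g x post = cong (_+_ (g [] x post)) (laplaceSum-shift g (x ∷ []) [] post)

  laplaceSum-cong : ∀ g h pre post → (∀ a x b → pre ++ post ≡ a ++ x ∷ b → g a x b ≈ h a x b) →
                    laplaceSum g pre post ≈ laplaceSum h pre post
  laplaceSum-cong g h pre []         _   = ≈-refl
  laplaceSum-cong g h pre (x ∷ post) g≈h = +-cong (g≈h pre x post refl)
    (laplaceSum-cong g h (pre ++ x ∷ []) post
      (λ a y b eq → g≈h a y b (≡.trans (≡.sym (ListP.++-assoc pre (x ∷ []) post)) eq)))

  laplaceSum-≈0 : ∀ g pre post → (∀ a x b → pre ++ post ≡ a ++ x ∷ b → g a x b ≈ 0#) → laplaceSum g pre post ≈ 0#
  laplaceSum-≈0 g pre post g≈0 = trans (laplaceSum-cong g (λ _ _ _ → 0#) pre post g≈0) (zeros pre post)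
    where
    zeros : ∀ pre post → laplaceSum (λ _ _ _ → 0#) pre post ≈ 0#
    zeros pre []         = ≈-refl
    zeros pre (x ∷ post) = trans (+-identityˡ _) (zeros (pre ++ x ∷ []) post)

  laplaceSum-*ˡ : ∀ k g pre post → laplaceSum (λ a x b → k * g a x b) pre post ≈ k * laplaceSum g pre post
  laplaceSum-*ˡ k g pre []         = sym (zeroʳ k)
  laplaceSum-*ˡ k g pre (x ∷ post) =
    trans (+-cong ≈-refl (laplaceSum-*ˡ k g (pre ++ x ∷ []) post)) (sym (distribˡ k _ _))

  laplaceSum-*ʳ : ∀ k g pre post → laplaceSum (λ a x b → g a x b * k) pre post ≈ laplaceSum g pre post * k
  laplaceSum-*ʳ k g pre []         = sym (zeroˡ k)
  laplaceSum-*ʳ k g pre (x ∷ post) =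
    trans (+-cong ≈-refl (laplaceSum-*ʳ k g (pre ++ x ∷ []) post)) (sym (distribʳ k _ _))

  laplaceSum-++ : ∀ g xs ys →
    laplaceSum g [] (xs ++ ys) ≈ laplaceSum (λ a x b → g a x (b ++ ys)) [] xs + laplaceSum (λ a → g (xs ++ a)) [] ys
  laplaceSum-++ g []       ys = sym (+-identityˡ _)
  laplaceSum-++ g (x ∷ xs) ys = begin
    laplaceSum g [] (x ∷ xs ++ ys)                  ≡⟨ laplaceSum-∷ g x (xs ++ ys) ⟩
    g [] x (xs ++ ys) + laplaceSum (λ a → g (x ∷ a)) [] (xs ++ ys)
      ≈⟨ +-cong ≈-refl (laplaceSum-++ (λ a → g (x ∷ a)) xs ys) ⟩
    g [] x (xs ++ ys) + (Sxs + Sys)                 ≈⟨ sym (+-assoc _ _ _) ⟩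
    (g [] x (xs ++ ys) + Sxs) + Sys
      ≡⟨ cong (_+ Sys) (≡.sym (laplaceSum-∷ (λ a y b → g a y (b ++ ys)) x xs)) ⟩
    laplaceSum (λ a y b → g a y (b ++ ys)) [] (x ∷ xs) + Sys ∎
    where
    Sxs Sys : Carrier
    Sxs = laplaceSum (λ a y b → g (x ∷ a) y (b ++ ys)) [] xs
    Sys = laplaceSum (λ a → g (x ∷ xs ++ a)) [] ys

  laplaceSum-map : ∀ g (f : A → A) pre post →
    laplaceSum g (map f pre) (map f post) ≡ laplaceSum (λ a x b → g (map f a) (f x) (map f b)) pre post
  laplaceSum-map g f pre []         = refl
  laplaceSum-map g f pre (x ∷ post) = cong (_+_ _)
    (≡.trans (cong (λ l → laplaceSum g l (map f post)) (≡.sym (ListP.map-++ f pre (x ∷ []))))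
             (laplaceSum-map g f (pre ++ x ∷ []) post))


  det-cong : ∀ M N → (∀ r x → M r x ≈ N r x) → ∀ rs cs → det M rs cs ≈ det N rs cs
  det-cong M N M≈N []       cs = ≈-refl
  det-cong M N M≈N (r ∷ rs) cs = begin
    det M (r ∷ rs) cs                 ≡⟨ det-∷ M r rs cs ⟩
    laplaceSum (cofactor M r rs) [] cs ≈⟨ laplaceSum-cong _ _ [] cs
      (λ a x b _ → *-cong (*-cong ≈-refl (M≈N r x)) (det-cong M N M≈N rs (a ++ b))) ⟩
    laplaceSum (cofactor N r rs) [] cs ≡⟨ ≡.sym (det-∷ N r rs cs) ⟩
    det N (r ∷ rs) cs                 ∎

  det-mapColumns : ∀ M (f : A → A) rs cs → det (λ r x → M r (f x)) rs cs ≡ det M rs (map f cs)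
  det-mapColumns M f []       cs = refl
  det-mapColumns M f (r ∷ rs) cs = ≡.trans (det-∷ _ r rs cs) (≡.trans
    (laplaceSum-ext _ _ (λ a x b → cong₂ _*_ (cong (λ k → sgn k * M r (f x)) (≡.sym (ListP.length-map f a)))
      (≡.trans (det-mapColumns M f rs (a ++ b)) (cong (det M rs) (ListP.map-++ f a b)))) [] cs)
    (≡.trans (≡.sym (laplaceSum-map (cofactor M r rs) f [] cs)) (≡.sym (det-∷ M r rs (map f cs)))))

  private
    module CM = CommutativeMonoidSolver *-commutativeMonoid

    v₀ v₁ v₂ v₃ : CM.Expr 4
    v₀ = CM.var Fin.zero
    v₁ = CM.var (Fin.suc Fin.zero)
    v₂ = CM.var (Fin.suc (Fin.suc Fin.zero))
    v₃ = CM.var (Fin.suc (Fin.suc (Fin.suc Fin.zero)))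

    open CM using (_⊕_; prove)

    xy∙zw≈x∙yzw : ∀ x y z w → (x * y) * (z * w) ≈ x * (y * z * w)
    xy∙zw≈x∙yzw x y z w = prove 4 ((v₀ ⊕ v₁) ⊕ (v₂ ⊕ v₃)) (v₀ ⊕ ((v₁ ⊕ v₂) ⊕ v₃)) (x ∷ y ∷ z ∷ w ∷ [])

    xy∙zw≈z∙xyw : ∀ x y z w → x * y * (z * w) ≈ z * (x * y * w)
    xy∙zw≈z∙xyw x y z w = prove 4 ((v₀ ⊕ v₁) ⊕ (v₂ ⊕ v₃)) (v₂ ⊕ ((v₀ ⊕ v₁) ⊕ v₃)) (x ∷ y ∷ z ∷ w ∷ [])

    x+[y+z]≈y+[x+z] : ∀ x y z → x + (y + z) ≈ y + (x + z)
    x+[y+z]≈y+[x+z] x y z = trans (sym (+-assoc x y z)) (trans (+-cong (+-comm x y) ≈-refl) (+-assoc y x z))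

  length-++-∷ : ∀ (a : List A) x b → length (a ++ x ∷ b) ≡ ℕ.suc (length (a ++ b))
  length-++-∷ a x b = ≡.trans (ListP.length-++ a) (≡.trans (ℕP.+-suc (length a) (length b))
    (cong ℕ.suc (≡.sym (ListP.length-++ a))))

  det-moveToFront : ∀ M rs xs c ys → length rs ≡ length xs ℕ.+ ℕ.suc (length ys) →
                    det M rs (xs ++ c ∷ ys) ≈ sgn (length xs) * det M rs (c ∷ xs ++ ys)
  det-moveToFront M [] xs c ys eq = ⊥-elim (ℕP.m+1+n≢0 (length xs) (≡.sym eq))
  det-moveToFront M (r ∷ rs) xs c ys eq = begin
    det M (r ∷ rs) (xs ++ c ∷ ys)                      ≡⟨ det-∷ M r rs (xs ++ c ∷ ys) ⟩
    laplaceSum C [] (xs ++ c ∷ ys)                      ≈⟨ laplaceSum-++ C xs (c ∷ ys) ⟩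
    Before + laplaceSum (λ a → C (xs ++ a)) [] (c ∷ ys) ≡⟨ cong (_+_ Before) (laplaceSum-∷ (λ a → C (xs ++ a)) c ys) ⟩
    Before + (C (xs ++ []) c ys + After)                ≈⟨ +-cong before (+-cong moved after) ⟩
    s * Before′ + (s * Moved + s * After′)              ≈⟨ x+[y+z]≈y+[x+z] _ _ _ ⟩
    s * Moved + (s * Before′ + s * After′)              ≈⟨ sym (trans (distribˡ s Moved _)
                                                              (+-cong ≈-refl (distribˡ s _ _))) ⟩
    s * (Moved + (Before′ + After′))                    ≈⟨ *-cong ≈-refl (+-cong ≈-refl
                                                              (sym (laplaceSum-++ (λ a → C (c ∷ a)) xs ys))) ⟩
    s * (Moved + laplaceSum (λ a → C (c ∷ a)) [] (xs ++ ys))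
      ≡⟨ cong (s *_) (≡.trans (≡.sym (laplaceSum-∷ C c (xs ++ ys))) (≡.sym (det-∷ M r rs (c ∷ xs ++ ys)))) ⟩
    s * det M (r ∷ rs) (c ∷ xs ++ ys)                   ∎
    where
    C : Summand
    C = cofactor M r rs
    s : Carrier
    s = sgn (length xs)
    Before After Before′ After′ Moved : Carrier
    Before  = laplaceSum (λ a x b → C a x (b ++ c ∷ ys)) [] xs
    After   = laplaceSum (λ a → C (xs ++ c ∷ a)) [] ys
    Before′ = laplaceSum (λ a x b → C (c ∷ a) x (b ++ ys)) [] xs
    After′  = laplaceSum (λ a → C (c ∷ xs ++ a)) [] ys
    Moved   = C [] c (xs ++ ys)
    |rs| : length rs ≡ length xs ℕ.+ length ys
    |rs| = ℕP.suc-injective (≡.trans eq (ℕP.+-suc (length xs) (length ys)))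
    moved : C (xs ++ []) c ys ≈ s * Moved
    moved = begin
      sgn (length (xs ++ [])) * M r c * det M rs ((xs ++ []) ++ ys)
        ≡⟨ cong (λ l → sgn (length l) * M r c * det M rs (l ++ ys)) (ListP.++-identityʳ xs) ⟩
      s * M r c * det M rs (xs ++ ys)    ≈⟨ *-assoc _ _ _ ⟩
      s * (M r c * det M rs (xs ++ ys))  ≈⟨ *-cong ≈-refl (*-cong (sym (*-identityˡ _)) ≈-refl) ⟩
      s * Moved                          ∎
    before : Before ≈ s * Before′
    before = trans (laplaceSum-cong _ _ [] xs term) (laplaceSum-*ˡ s _ [] xs)
      where
      term : ∀ a x b → xs ≡ a ++ x ∷ b → C a x (b ++ c ∷ ys) ≈ s * C (c ∷ a) x (b ++ ys)
      term a x b refl = begin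
        sgn (length a) * M r x * det M rs (a ++ b ++ c ∷ ys)
          ≡⟨ cong (λ l → sgn (length a) * M r x * det M rs l) (≡.sym (ListP.++-assoc a b (c ∷ ys))) ⟩
        sgn (length a) * M r x * det M rs ((a ++ b) ++ c ∷ ys)
          ≈⟨ *-cong ≈-refl (det-moveToFront M rs (a ++ b) c ys |rs|′) ⟩
        sgn (length a) * M r x * (sgn (length (a ++ b)) * det M rs (c ∷ (a ++ b) ++ ys))
          ≈⟨ interchange _ _ _ _ ⟩
        (sgn (length a) * sgn (length (a ++ b))) * (M r x * det M rs (c ∷ (a ++ b) ++ ys))
          ≈⟨ *-cong signs ≈-refl ⟩
        (s * sgn (ℕ.suc (length a))) * (M r x * det M rs (c ∷ (a ++ b) ++ ys))
          ≈⟨ xy∙zw≈x∙yzw _ _ _ _ ⟩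
        s * (sgn (ℕ.suc (length a)) * M r x * det M rs (c ∷ (a ++ b) ++ ys))
          ≡⟨ cong (λ l → s * (sgn (ℕ.suc (length a)) * M r x * det M rs (c ∷ l))) (ListP.++-assoc a b ys) ⟩
        s * C (c ∷ a) x (b ++ ys) ∎
        where
        |xs| : length xs ≡ ℕ.suc (length (a ++ b))
        |xs| = length-++-∷ a x b
        |rs|′ : length rs ≡ length (a ++ b) ℕ.+ ℕ.suc (length ys)
        |rs|′ = ≡.trans |rs| (≡.trans (cong (ℕ._+ length ys) |xs|) (≡.sym (ℕP.+-suc _ (length ys))))
        -- |a| + |a ++ b| and |xs| + (1 + |a|) have the same parity.
        signs : sgn (length a) * sgn (length (a ++ b)) ≈ s * sgn (ℕ.suc (length a))
        signs = begin
          sgn (length a) * sgn (length (a ++ b))       ≈⟨ sym (sgn-+ (length a) (length (a ++ b))) ⟩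
          sgn (length a ℕ.+ length (a ++ b))           ≈⟨ sym (sgn-+-double (length a ℕ.+ length (a ++ b)) (ℕ.suc (length a))) ⟩
          sgn (length a ℕ.+ length (a ++ b) ℕ.+ (ℕ.suc (length a) ℕ.+ ℕ.suc (length a)))
            ≡⟨ cong sgn (arith (length a) (length (a ++ b))) ⟩
          sgn (ℕ.suc (length (a ++ b)) ℕ.+ ℕ.suc (length a) ℕ.+ (length a ℕ.+ length a))
            ≈⟨ sgn-+-double (ℕ.suc (length (a ++ b)) ℕ.+ ℕ.suc (length a)) (length a) ⟩
          sgn (ℕ.suc (length (a ++ b)) ℕ.+ ℕ.suc (length a)) ≡⟨ cong (λ k → sgn (k ℕ.+ ℕ.suc (length a))) (≡.sym |xs|) ⟩
          sgn (length xs ℕ.+ ℕ.suc (length a))          ≈⟨ sgn-+ (length xs) (ℕ.suc (length a)) ⟩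
          s * sgn (ℕ.suc (length a))                   ∎
          where
          open import Data.Nat.Tactic.RingSolver using (solve-∀)
          arith : ∀ p q → p ℕ.+ q ℕ.+ (ℕ.suc p ℕ.+ ℕ.suc p) ≡ ℕ.suc q ℕ.+ ℕ.suc p ℕ.+ (p ℕ.+ p)
          arith = solve-∀
    after : After ≈ s * After′
    after = trans (laplaceSum-cong _ _ [] ys term) (laplaceSum-*ˡ s _ [] ys)
      where
      term : ∀ a x b → ys ≡ a ++ x ∷ b → C (xs ++ c ∷ a) x b ≈ s * C (c ∷ xs ++ a) x b
      term a x b refl = begin
        sgn (length (xs ++ c ∷ a)) * M r x * det M rs ((xs ++ c ∷ a) ++ b)
          ≡⟨ cong (λ l → sgn (length (xs ++ c ∷ a)) * M r x * det M rs l) (ListP.++-assoc xs (c ∷ a) b) ⟩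
        sgn (length (xs ++ c ∷ a)) * M r x * det M rs (xs ++ c ∷ (a ++ b))
          ≈⟨ *-cong ≈-refl (det-moveToFront M rs xs c (a ++ b) |rs|′) ⟩
        sgn (length (xs ++ c ∷ a)) * M r x * (s * det M rs (c ∷ xs ++ (a ++ b)))
          ≈⟨ xy∙zw≈z∙xyw _ _ _ _ ⟩
        s * (sgn (length (xs ++ c ∷ a)) * M r x * det M rs (c ∷ xs ++ (a ++ b)))
          ≡⟨ cong₂ (λ u l → s * (sgn u * M r x * det M rs (c ∷ l))) (length-++-∷ xs c a) (≡.sym (ListP.++-assoc xs a b)) ⟩
        s * C (c ∷ xs ++ a) x b ∎
        where
        |rs|′ : length rs ≡ length xs ℕ.+ ℕ.suc (length (a ++ b))
        |rs|′ = ≡.trans |rs| (cong (length xs ℕ.+_) (length-++-∷ a x b))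

  det-swapColumns : ∀ M rs pre x y ys → length rs ≡ length pre ℕ.+ ℕ.suc (ℕ.suc (length ys)) →
                    det M rs (pre ++ x ∷ y ∷ ys) ≈± det M rs (pre ++ y ∷ x ∷ ys)
  det-swapColumns M rs pre x y ys eq = s′ * s , IsSign-* (IsSign-sgn (length (pre ++ x ∷ []))) (IsSign-sgn (length pre)) , (begin
    det M rs (pre ++ x ∷ y ∷ ys)             ≡⟨ cong (det M rs) (≡.sym (ListP.++-assoc pre (x ∷ []) (y ∷ ys))) ⟩
    det M rs ((pre ++ x ∷ []) ++ y ∷ ys)     ≈⟨ det-moveToFront M rs (pre ++ x ∷ []) y ys eq′ ⟩
    s′ * det M rs (y ∷ (pre ++ x ∷ []) ++ ys) ≡⟨ cong (λ l → s′ * det M rs (y ∷ l)) (ListP.++-assoc pre (x ∷ []) ys) ⟩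
    s′ * det M rs (y ∷ pre ++ x ∷ ys)        ≈⟨ *-cong ≈-refl (sym y-back) ⟩
    s′ * (s * det M rs (pre ++ y ∷ x ∷ ys))  ≈⟨ sym (*-assoc _ _ _) ⟩
    (s′ * s) * det M rs (pre ++ y ∷ x ∷ ys)  ∎)
    where
    s′ s : Carrier
    s′ = sgn (length (pre ++ x ∷ []))
    s  = sgn (length pre)
    eq′ : length rs ≡ length (pre ++ x ∷ []) ℕ.+ ℕ.suc (length ys)
    eq′ = ≡.trans eq (≡.trans (≡.sym (ℕP.+-assoc (length pre) 1 (ℕ.suc (length ys))))
            (cong (ℕ._+ ℕ.suc (length ys)) (≡.sym (ListP.length-++ pre))))
    y-back : s * det M rs (pre ++ y ∷ x ∷ ys) ≈ det M rs (y ∷ pre ++ x ∷ ys)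
    y-back = begin
      s * det M rs (pre ++ y ∷ x ∷ ys)        ≈⟨ *-cong ≈-refl (det-moveToFront M rs pre y (x ∷ ys) eq) ⟩
      s * (s * det M rs (y ∷ pre ++ x ∷ ys))  ≈⟨ sym (*-assoc _ _ _) ⟩
      (s * s) * det M rs (y ∷ pre ++ x ∷ ys)  ≈⟨ *-cong (sgn-square (length pre)) ≈-refl ⟩
      1# * det M rs (y ∷ pre ++ x ∷ ys)       ≈⟨ *-identityˡ _ ⟩
      det M rs (y ∷ pre ++ x ∷ ys)            ∎

  private
    det-permuteColumns-after : ∀ M pre {xs ys} → xs ↭ ys → ∀ rs → length rs ≡ length pre ℕ.+ length xs →
                               det M rs (pre ++ xs) ≈± det M rs (pre ++ ys)
    det-permuteColumns-after M pre Perm.refl rs eq = ≈⇒≈± ≈-refl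
    det-permuteColumns-after M pre (Perm.prep x xs↭ys) rs eq =
      subst₂ _≈±_ (cong (det M rs) (ListP.++-assoc pre (x ∷ []) _)) (cong (det M rs) (ListP.++-assoc pre (x ∷ []) _))
        (det-permuteColumns-after M (pre ++ x ∷ []) xs↭ys rs
          (≡.trans eq (≡.trans (≡.sym (ℕP.+-assoc (length pre) 1 _)) (cong (ℕ._+ _) (≡.sym (ListP.length-++ pre))))))
    det-permuteColumns-after M pre (Perm.swap x y xs↭ys) rs eq = ≈±-trans
      (subst₂ _≈±_ (cong (det M rs) (ListP.++-assoc pre (x ∷ y ∷ []) _)) (cong (det M rs) (ListP.++-assoc pre (x ∷ y ∷ []) _))
        (det-permuteColumns-after M (pre ++ x ∷ y ∷ []) xs↭ys rs
          (≡.trans eq (≡.trans (≡.sym (ℕP.+-assoc (length pre) 2 _)) (cong (ℕ._+ _) (≡.sym (ListP.length-++ pre)))))))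
      (det-swapColumns M rs pre x y _ (≡.trans eq (cong (λ k → length pre ℕ.+ ℕ.suc (ℕ.suc k)) (↭-length xs↭ys))))
    det-permuteColumns-after M pre (Perm.trans xs↭ys ys↭zs) rs eq = ≈±-trans
      (det-permuteColumns-after M pre xs↭ys rs eq)
      (det-permuteColumns-after M pre ys↭zs rs (≡.trans eq (cong (length pre ℕ.+_) (↭-length xs↭ys))))

  det-permuteColumns : ∀ M {xs ys} → xs ↭ ys → ∀ rs → length rs ≡ length xs → det M rs xs ≈± det M rs ys
  det-permuteColumns M = det-permuteColumns-after M []

  module BlockTriangular (M : Matrix) (P : A → Bool) where

    ZeroBlock : List A → List A → Set ℓ
    ZeroBlock rows cn = ∀ z w → z ∈ rows → w ∈ cn → P z ≡ true → M z w ≈ 0#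

    -- sgn (inversions rows) is the sign of the permutation moving the P-rows to the front.
    inversions : List A → ℕ
    inversions []       = 0
    inversions (z ∷ zs) = (if P z then 0 else length (filterᵇ P zs)) ℕ.+ inversions zs

    private
      ZeroBlock-tail : ∀ {r rs cn} → ZeroBlock (r ∷ rs) cn → ZeroBlock rs cn
      ZeroBlock-tail zb z w z∈ w∈ Pz = zb z w (there z∈) w∈ Pz

      ZeroBlock-remove : ∀ {rs cn} a x b → ZeroBlock rs cn → cn ≡ a ++ x ∷ b → ZeroBlock rs (a ++ b)
      ZeroBlock-remove a x b zb refl z w z∈ w∈ Pz with ∈-++⁻ a w∈
      ... | inj₁ w∈a = zb z w z∈ (∈-++⁺ˡ w∈a) Pz
      ... | inj₂ w∈b = zb z w z∈ (∈-++⁺ʳ a (there w∈b)) Pz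

      ∈-split : ∀ {cn a : List A} {x : A} {b : List A} → cn ≡ a ++ x ∷ b → x ∈ cn
      ∈-split {a = a} refl = ∈-++⁺ʳ a (here refl)

      length-split : ∀ {cn a : List A} {x : A} {b : List A} → cn ≡ a ++ x ∷ b → length cn ≡ ℕ.suc (length (a ++ b))
      length-split {a = a} {x} {b} refl = length-++-∷ a x b

      cofactor-≈0ˡ : ∀ s m d → m ≈ 0# → s * m * d ≈ 0#
      cofactor-≈0ˡ s m d m≈0 = trans (*-cong (trans (*-cong ≈-refl m≈0) (zeroʳ s)) ≈-refl) (zeroˡ d)

      cofactor-≈0ʳ : ∀ s m d → d ≈ 0# → s * m * d ≈ 0#
      cofactor-≈0ʳ s m d d≈0 = trans (*-cong ≈-refl d≈0) (zeroʳ _)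

    det-≈0 : ∀ rows cq cn → ZeroBlock rows cn → length cq < length (filterᵇ P rows) → det M rows (cq ++ cn) ≈ 0#
    det-≈0 (r ∷ rs) cq cn zb lt = begin
      det M (r ∷ rs) (cq ++ cn)                    ≡⟨ det-∷ M r rs (cq ++ cn) ⟩
      laplaceSum C [] (cq ++ cn)                    ≈⟨ laplaceSum-++ C cq cn ⟩
      laplaceSum (λ a x b → C a x (b ++ cn)) [] cq + laplaceSum (λ a → C (cq ++ a)) [] cn ≈⟨ +-cong inCq (inCn (P r) refl) ⟩
      0# + 0#                                      ≈⟨ +-identityˡ 0# ⟩
      0#                                           ∎
      where
      C : Summand
      C = cofactor M r rs
      |cq|≤ : length cq ≤ length (filterᵇ P rs)
      |cq|≤ with P r
      ... | true  = ℕP.≤-pred lt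
      ... | false = ℕP.≤-pred (ℕP.m≤n⇒m≤1+n lt)
      inCq : laplaceSum (λ a x b → C a x (b ++ cn)) [] cq ≈ 0#
      inCq = laplaceSum-≈0 _ [] cq (λ a x b cq≡ → cofactor-≈0ʳ _ _ _
        (trans (reflexive (cong (det M rs) (≡.sym (ListP.++-assoc a b cn))))
               (det-≈0 rs (a ++ b) cn (ZeroBlock-tail zb) (ℕP.≤-trans (ℕP.≤-reflexive (≡.sym (length-split cq≡))) |cq|≤))))
      inCn : ∀ b → P r ≡ b → laplaceSum (λ a → C (cq ++ a)) [] cn ≈ 0#
      inCn true  Pr = laplaceSum-≈0 _ [] cn (λ a x b cn≡ → cofactor-≈0ˡ _ _ _ (zb r x (here refl) (∈-split cn≡) Pr))
      inCn false Pr = laplaceSum-≈0 _ [] cn (λ a x b cn≡ → cofactor-≈0ʳ _ _ _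
        (trans (reflexive (cong (det M rs) (ListP.++-assoc cq a b)))
               (det-≈0 rs cq (a ++ b) (ZeroBlock-remove a x b (ZeroBlock-tail zb) cn≡)
                 (subst (λ l → length cq < length l) (filterᵇ-reject Pr) lt))))
        where
        filterᵇ-reject : P r ≡ false → filterᵇ P (r ∷ rs) ≡ filterᵇ P rs
        filterᵇ-reject Pr rewrite Pr = refl

    private
      u₀ u₁ u₂ u₃ u₄ u₅ : CM.Expr 6
      u₀ = CM.var Fin.zero
      u₁ = CM.var (Fin.suc Fin.zero)
      u₂ = CM.var (Fin.suc (Fin.suc Fin.zero))
      u₃ = CM.var (Fin.suc (Fin.suc (Fin.suc Fin.zero)))
      u₄ = CM.var (Fin.suc (Fin.suc (Fin.suc (Fin.suc Fin.zero))))
      u₅ = CM.var (Fin.suc (Fin.suc (Fin.suc (Fin.suc (Fin.suc Fin.zero)))))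

      reassocʳ : ∀ s m σ d y → s * m * (σ * (d * y)) ≈ σ * ((s * m * d) * y)
      reassocʳ s m σ d y = trans (x∙yz≈y∙xz (s * m) σ (d * y)) (*-cong ≈-refl (sym (*-assoc (s * m) d y)))

      reassocˡ : ∀ sc sa m σ x y → (sc * sa) * m * (σ * (x * y)) ≈ ((sc * σ) * x) * (sa * m * y)
      reassocˡ sc sa m σ x y =
        prove 6 (((u₀ ⊕ u₁) ⊕ u₂) ⊕ (u₃ ⊕ (u₄ ⊕ u₅))) (((u₀ ⊕ u₃) ⊕ u₄) ⊕ ((u₁ ⊕ u₂) ⊕ u₅))
          (sc ∷ sa ∷ m ∷ σ ∷ x ∷ y ∷ [])

    det-blocks : ∀ rows cq cn → ZeroBlock rows cn → length (filterᵇ P rows) ≡ length cq →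
      det M rows (cq ++ cn) ≈ sgn (inversions rows) * (det M (filterᵇ P rows) cq * det M (filterᵇ (not ∘ P) rows) cn)
    det-blocks [] [] cn zb eq = sym (trans (*-identityˡ _) (*-identityˡ _))
    det-blocks (r ∷ rs) cq cn zb eq with P r in Pr
    ... | true = begin
      det M (r ∷ rs) (cq ++ cn)                    ≡⟨ det-∷ M r rs (cq ++ cn) ⟩
      laplaceSum C [] (cq ++ cn)                    ≈⟨ laplaceSum-++ C cq cn ⟩
      laplaceSum (λ a x b → C a x (b ++ cn)) [] cq + laplaceSum (λ a → C (cq ++ a)) [] cn
        ≈⟨ +-cong inCq (laplaceSum-≈0 _ [] cn (λ a x b cn≡ → cofactor-≈0ˡ _ _ _ (zb r x (here refl) (∈-split cn≡) Pr))) ⟩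
      σ * (det M (r ∷ filterᵇ P rs) cq * Y) + 0#   ≈⟨ +-identityʳ _ ⟩
      σ * (det M (r ∷ filterᵇ P rs) cq * Y)        ∎
      where
      C : Summand
      C = cofactor M r rs
      σ Y : Carrier
      σ = sgn (inversions rs)
      Y = det M (filterᵇ (not ∘ P) rs) cn
      inCq : laplaceSum (λ a x b → C a x (b ++ cn)) [] cq ≈ σ * (det M (r ∷ filterᵇ P rs) cq * Y)
      inCq = begin
        laplaceSum (λ a x b → C a x (b ++ cn)) [] cq
          ≈⟨ laplaceSum-cong _ _ [] cq (λ a x b cq≡ → begin
               sgn (length a) * M r x * det M rs (a ++ b ++ cn)
                 ≡⟨ cong (λ l → sgn (length a) * M r x * det M rs l) (≡.sym (ListP.++-assoc a b cn)) ⟩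
               sgn (length a) * M r x * det M rs ((a ++ b) ++ cn)
                 ≈⟨ *-cong ≈-refl (det-blocks rs (a ++ b) cn (ZeroBlock-tail zb) (ℕP.suc-injective (≡.trans eq (length-split cq≡)))) ⟩
               sgn (length a) * M r x * (σ * (det M (filterᵇ P rs) (a ++ b) * Y)) ≈⟨ reassocʳ _ _ _ _ _ ⟩
               σ * (cofactor M r (filterᵇ P rs) a x b * Y) ∎) ⟩
        laplaceSum (λ a x b → σ * (cofactor M r (filterᵇ P rs) a x b * Y)) [] cq  ≈⟨ laplaceSum-*ˡ σ _ [] cq ⟩
        σ * laplaceSum (λ a x b → cofactor M r (filterᵇ P rs) a x b * Y) [] cq    ≈⟨ *-cong ≈-refl (laplaceSum-*ʳ Y _ [] cq) ⟩
        σ * (laplaceSum (cofactor M r (filterᵇ P rs)) [] cq * Y)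
          ≡⟨ cong (λ u → σ * (u * Y)) (≡.sym (det-∷ M r (filterᵇ P rs) cq)) ⟩
        σ * (det M (r ∷ filterᵇ P rs) cq * Y) ∎
    ... | false = begin
      det M (r ∷ rs) (cq ++ cn)                    ≡⟨ det-∷ M r rs (cq ++ cn) ⟩
      laplaceSum C [] (cq ++ cn)                    ≈⟨ laplaceSum-++ C cq cn ⟩
      laplaceSum (λ a x b → C a x (b ++ cn)) [] cq + laplaceSum (λ a → C (cq ++ a)) [] cn ≈⟨ +-cong inCq inCn ⟩
      0# + K * det M (r ∷ filterᵇ (not ∘ P) rs) cn ≈⟨ +-identityˡ _ ⟩
      K * det M (r ∷ filterᵇ (not ∘ P) rs) cn      ≈⟨ *-assoc _ _ _ ⟩
      sgn (length (filterᵇ P rs) ℕ.+ inversions rs) * (X * det M (r ∷ filterᵇ (not ∘ P) rs) cn) ∎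
      where
      C : Summand
      C = cofactor M r rs
      σ X K : Carrier
      σ = sgn (inversions rs)
      X = det M (filterᵇ P rs) cq
      K = sgn (length (filterᵇ P rs) ℕ.+ inversions rs) * X
      inCq : laplaceSum (λ a x b → C a x (b ++ cn)) [] cq ≈ 0#
      inCq = laplaceSum-≈0 _ [] cq (λ a x b cq≡ → cofactor-≈0ʳ _ _ _
        (trans (reflexive (cong (det M rs) (≡.sym (ListP.++-assoc a b cn))))
               (det-≈0 rs (a ++ b) cn (ZeroBlock-tail zb)
                 (ℕP.≤-reflexive (≡.trans (≡.sym (length-split cq≡)) (≡.sym eq))))))
      inCn : laplaceSum (λ a → C (cq ++ a)) [] cn ≈ K * det M (r ∷ filterᵇ (not ∘ P) rs) cn
      inCn = begin
        laplaceSum (λ a → C (cq ++ a)) [] cn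
          ≈⟨ laplaceSum-cong _ _ [] cn (λ a x b cn≡ → begin
               sgn (length (cq ++ a)) * M r x * det M rs ((cq ++ a) ++ b)
                 ≡⟨ cong (λ l → sgn (length (cq ++ a)) * M r x * det M rs l) (ListP.++-assoc cq a b) ⟩
               sgn (length (cq ++ a)) * M r x * det M rs (cq ++ (a ++ b))
                 ≈⟨ *-cong (*-cong (trans (reflexive (cong sgn (ListP.length-++ cq))) (sgn-+ (length cq) (length a))) ≈-refl)
                      (det-blocks rs cq (a ++ b) (ZeroBlock-remove a x b (ZeroBlock-tail zb) cn≡) eq) ⟩
               (sgn (length cq) * sgn (length a)) * M r x * (σ * (X * det M (filterᵇ (not ∘ P) rs) (a ++ b)))
                 ≈⟨ reassocˡ _ _ _ _ _ _ ⟩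
               ((sgn (length cq) * σ) * X) * cofactor M r (filterᵇ (not ∘ P) rs) a x b
                 ≈⟨ *-cong (*-cong (trans (sym (sgn-+ (length cq) (inversions rs)))
                      (reflexive (cong (λ k → sgn (k ℕ.+ inversions rs)) (≡.sym eq)))) ≈-refl) ≈-refl ⟩
               K * cofactor M r (filterᵇ (not ∘ P) rs) a x b ∎) ⟩
        laplaceSum (λ a x b → K * cofactor M r (filterᵇ (not ∘ P) rs) a x b) [] cn ≈⟨ laplaceSum-*ˡ K _ [] cn ⟩
        K * laplaceSum (cofactor M r (filterᵇ (not ∘ P) rs)) [] cn
          ≡⟨ cong (K *_) (≡.sym (det-∷ M r (filterᵇ (not ∘ P) rs) cn)) ⟩
        K * det M (r ∷ filterᵇ (not ∘ P) rs) cn ∎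

  det-split : ∀ M (P Q : A → Bool) rows cols →
    (∀ z w → z ∈ rows → w ∈ cols → P z ≡ true → Q w ≡ false → M z w ≈ 0#) →
    length rows ≡ length cols → length (filterᵇ P rows) ≡ length (filterᵇ Q cols) →
    det M rows cols ≈± det M (filterᵇ P rows) (filterᵇ Q cols) * det M (filterᵇ (not ∘ P) rows) (filterᵇ (not ∘ Q) cols)
  det-split M P Q rows cols zero |rows|≡|cols| |P|≡|Q| = ≈±-trans
    (det-permuteColumns M (filterᵇ-partition-↭ Q cols) rows |rows|≡|cols|)
    (sgn (inversions rows) , IsSign-sgn (inversions rows) ,
      det-blocks rows (filterᵇ Q cols) (filterᵇ (not ∘ Q) cols) zeroBlock |P|≡|Q|)
    where
    open BlockTriangular M P
    zeroBlock : ZeroBlock rows (filterᵇ (not ∘ Q) cols)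
    zeroBlock z w z∈ w∈ Pz with ∈-filterᵇ⁻ (not ∘ Q) cols w∈
    ... | w∈cols , ¬Qw = zero z w z∈ w∈cols Pz (≡.trans (≡.sym (BoolP.not-involutive (Q w))) (cong not ¬Qw))

  det-splitByClasses : ∀ M {B : Set} (P Q : B → A → Bool) (L : List B) rows cols →
    (∀ r z w → z ∈ rows → w ∈ cols → P r z ≡ true → Q r w ≡ false → M z w ≈ 0#) →
    (∀ r → r ∈ L → length (filterᵇ (P r) rows) ≡ length (filterᵇ (Q r) cols)) →
    AllPairs (λ r r′ → ∀ z → P r z ≡ true → P r′ z ≡ false) L →
    AllPairs (λ r r′ → ∀ w → Q r w ≡ true → Q r′ w ≡ false) L →
    (∀ z → z ∈ rows → Σ B (λ r → r ∈ L × P r z ≡ true)) →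
    length rows ≡ length cols →
    det M rows cols ≈± prodL (λ r → det M (filterᵇ (P r) rows) (filterᵇ (Q r) cols)) L
  det-splitByClasses M P Q [] [] cols _ _ _ _ _ _ = ≈⇒≈± ≈-refl
  det-splitByClasses M P Q [] (z ∷ rows) cols _ _ _ _ covered _ with covered z (here refl)
  ... | _ , () , _
  det-splitByClasses M P Q (r ∷ L) rows cols zero count (P-disj AllPairs.∷ P-disjs) (Q-disj AllPairs.∷ Q-disjs) covered |rows|≡|cols| =
    ≈±-trans (det-split M (P r) (Q r) rows cols (zero r) |rows|≡|cols| (count r (here refl)))
      (≈±-* (≈⇒≈± ≈-refl)
        (≈±-respʳ (prodL-cong _ _ L λ r′ r′∈ →
                    reflexive (cong₂ (det M) (rows′-absorb r′ r′∈) (cols′-absorb r′ r′∈)))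
          (det-splitByClasses M P Q L rows′ cols′ zero′ count′ P-disjs Q-disjs covered′ |rows′|≡|cols′|)))
    where
    rows′ cols′ : List A
    rows′ = filterᵇ (not ∘ P r) rows
    cols′ = filterᵇ (not ∘ Q r) cols
    flip : ∀ {a b : Bool} → (a ≡ true → b ≡ false) → b ≡ true → not a ≡ true
    flip {false} _     _  = refl
    flip {true}  a⇒¬b b with () ← ≡.trans (≡.sym (a⇒¬b refl)) b
    rows′-absorb : ∀ r′ → r′ ∈ L → filterᵇ (P r′) rows′ ≡ filterᵇ (P r′) rows
    rows′-absorb r′ r′∈ = filterᵇ-absorb (P r′) (not ∘ P r) rows (λ z → flip (All.lookup P-disj r′∈ z))
    cols′-absorb : ∀ r′ → r′ ∈ L → filterᵇ (Q r′) cols′ ≡ filterᵇ (Q r′) cols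
    cols′-absorb r′ r′∈ = filterᵇ-absorb (Q r′) (not ∘ Q r) cols (λ w → flip (All.lookup Q-disj r′∈ w))
    zero′ : ∀ r′ z w → z ∈ rows′ → w ∈ cols′ → P r′ z ≡ true → Q r′ w ≡ false → M z w ≈ 0#
    zero′ r′ z w z∈ w∈ =
      zero r′ z w (proj₁ (∈-filterᵇ⁻ (not ∘ P r) rows z∈)) (proj₁ (∈-filterᵇ⁻ (not ∘ Q r) cols w∈))
    count′ : ∀ r′ → r′ ∈ L → length (filterᵇ (P r′) rows′) ≡ length (filterᵇ (Q r′) cols′)
    count′ r′ r′∈ = ≡.trans (cong length (rows′-absorb r′ r′∈))
      (≡.trans (count r′ (there r′∈)) (cong length (≡.sym (cols′-absorb r′ r′∈))))
    covered′ : ∀ z → z ∈ rows′ → Σ _ (λ r′ → r′ ∈ L × P r′ z ≡ true)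
    covered′ z z∈ with ∈-filterᵇ⁻ (not ∘ P r) rows z∈
    ... | z∈rows , ¬Prz with covered z z∈rows
    ...   | _ , here refl , Prz with () ← ≡.trans (≡.sym (cong not Prz)) ¬Prz
    ...   | r′ , there r′∈ , Pr′z = r′ , r′∈ , Pr′z
    |rows′|≡|cols′| : length rows′ ≡ length cols′
    |rows′|≡|cols′| = ℕP.+-cancelˡ-≡ (length (filterᵇ (P r) rows)) _ _
      (≡.trans (length-filterᵇ-partition (P r) rows) (≡.trans |rows|≡|cols| (≡.trans (≡.sym (length-filterᵇ-partition (Q r) cols))
        (cong (ℕ._+ length cols′) (≡.sym (count r (here refl)))))))

  diagonalBlocks : ∀ {m} → (A → Vec Bool m) → Matrix → List A → Carrier
  diagonalBlocks {m} shape M C = prodL (λ I → let CI = filterᵇ (λ z → Vec-≡ᵇ (shape z) I) C in det M CI CI) (allSubsets m)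

  det-splitByShape : ∀ m (shape : A → Vec Bool m) M C →
    (∀ z w → z ∈ C → w ∈ C → ∀ i → Vec.lookup (shape z) i ≡ true → Vec.lookup (shape w) i ≡ false → M z w ≈ 0#) →
    det M C C ≈± diagonalBlocks shape M C
  det-splitByShape 0 shape M C _ = ≈⇒≈± (sym (trans (*-identityʳ _)
    (reflexive (cong (λ l → det M l l) (filterᵇ-all _ C (λ z → Vec-≡ᵇ-[] (shape z)))))))
    where
    Vec-≡ᵇ-[] : (v : Vec Bool 0) → Vec-≡ᵇ v [] ≡ true
    Vec-≡ᵇ-[] [] = refl
  det-splitByShape (ℕ.suc m) shape M C zero = ≈±-trans
    (det-split M head head C C (λ z w z∈ w∈ hz hw →
      zero z w z∈ w∈ Fin.zero (lookup-zero {shape z} hz) (lookup-zero {shape w} hw)) refl refl)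
    (≈±-respʳ (sym blocks≈) (≈±-* (det-splitByShape m tail M Cin (zero-tail head))
                                  (det-splitByShape m tail M Cout (zero-tail (not ∘ head)))))
    where
    head : A → Bool
    head z = Vec.head (shape z)
    tail : A → Vec Bool m
    tail z = Vec.tail (shape z)
    Cin Cout : List A
    Cin  = filterᵇ head C
    Cout = filterᵇ (not ∘ head) C
    lookup-zero : ∀ {v : Vec Bool (ℕ.suc m)} {b} → Vec.head v ≡ b → Vec.lookup v Fin.zero ≡ b
    lookup-zero {_ ∷ _} h = h
    lookup-suc : ∀ {v : Vec Bool (ℕ.suc m)} {i b} → Vec.lookup (Vec.tail v) i ≡ b → Vec.lookup v (Fin.suc i) ≡ b
    lookup-suc {_ ∷ _} h = h
    zero-tail : ∀ P → ∀ z w → z ∈ filterᵇ P C → w ∈ filterᵇ P C →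
                ∀ i → Vec.lookup (tail z) i ≡ true → Vec.lookup (tail w) i ≡ false → M z w ≈ 0#
    zero-tail P z w z∈ w∈ i hz hw = zero z w (proj₁ (∈-filterᵇ⁻ P C z∈)) (proj₁ (∈-filterᵇ⁻ P C w∈))
      (Fin.suc i) (lookup-suc {shape z} hz) (lookup-suc {shape w} hw)
    Vec-≡ᵇ-∷ : ∀ b z I → Vec-≡ᵇ (shape z) (b ∷ I) ≡ (if b then head z else not (head z)) ∧ Vec-≡ᵇ (tail z) I
    Vec-≡ᵇ-∷ b z I with shape z
    ... | x ∷ _ = cong (_∧ _) (≡ᵇ-sym b x)
      where
      ≡ᵇ-sym : ∀ b x → (if x then b else not b) ≡ (if b then x else not x)
      ≡ᵇ-sym true  true  = refl
      ≡ᵇ-sym true  false = refl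
      ≡ᵇ-sym false true  = refl
      ≡ᵇ-sym false false = refl
    blocks-∷ : ∀ b → prodL (λ I → let CI = filterᵇ (λ z → Vec-≡ᵇ (shape z) I) C in det M CI CI) (map (b ∷_) (allSubsets m))
                   ≈ diagonalBlocks tail M (filterᵇ (λ z → if b then head z else not (head z)) C)
    blocks-∷ b = trans (reflexive (prodL-map _ (b ∷_) (allSubsets m)))
      (prodL-cong _ _ (allSubsets m) (λ I _ → reflexive (cong (λ l → det M l l)
        (≡.trans (filterᵇ-cong _ _ C (λ z _ → Vec-≡ᵇ-∷ b z I)) (≡.sym (filterᵇ-filterᵇ _ _ C))))))
    blocks≈ : diagonalBlocks shape M C ≈ diagonalBlocks tail M Cin * diagonalBlocks tail M Cout
    blocks≈ = trans (prodL-++ _ (map (true ∷_) (allSubsets m)) (map (false ∷_) (allSubsets m)))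
      (*-cong (blocks-∷ true) (blocks-∷ false))

-- These, like frac and isIntᵇ above, coincide definitionally with their namesakes in Defs.Alg,
-- which carry a ring parameter they do not use.
infixl 6 _⊕_ _⊖_

_⊕_ _⊖_ : ∀ {n} → Vec ℚ n → Vec ℚ n → Vec ℚ n
u ⊕ v = Vec.zipWith ℚ._+_ u v
u ⊖ v = Vec.zipWith ℚ._-_ u v

scale : ∀ {n} → ℕ → Vec ℚ n → Vec ℚ n
scale p = Vec.map (⟦ + p ⟧ ℚ.*_)

η : ∀ {n} → ℕ → Vec ℚ n → Vec ℚ n
η p = Vec.map (λ x → frac (⟦ + p ⟧ ℚ.* x))

fracs : ∀ {n} → Vec ℚ n → Vec ℚ n
fracs = Vec.map frac

module _ {n : ℕ} where

  lookup-⊕ : ∀ (u v : Vec ℚ n) i → Vec.lookup (u ⊕ v) i ≡ Vec.lookup u i ℚ.+ Vec.lookup v i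
  lookup-⊕ u v i = VecP.lookup-zipWith ℚ._+_ i u v

  lookup-⊖ : ∀ (u v : Vec ℚ n) i → Vec.lookup (u ⊖ v) i ≡ Vec.lookup u i ℚ.- Vec.lookup v i
  lookup-⊖ u v i = VecP.lookup-zipWith ℚ._-_ i u v

  lookup-scale : ∀ p (u : Vec ℚ n) i → Vec.lookup (scale p u) i ≡ ⟦ + p ⟧ ℚ.* Vec.lookup u i
  lookup-scale p u i = VecP.lookup-map i _ u

  lookup-η : ∀ p (u : Vec ℚ n) i → Vec.lookup (η p u) i ≡ frac (⟦ + p ⟧ ℚ.* Vec.lookup u i)
  lookup-η p u i = VecP.lookup-map i _ u

  lookup-fracs : ∀ (u : Vec ℚ n) i → Vec.lookup (fracs u) i ≡ frac (Vec.lookup u i)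
  lookup-fracs u i = VecP.lookup-map i _ u

  ≡-by-lookup : ∀ (u v : Vec ℚ n) → (∀ i → Vec.lookup u i ≡ Vec.lookup v i) → u ≡ v
  ≡-by-lookup u v u≗v = ≡.trans (≡.sym (VecP.tabulate∘lookup u)) (≡.trans (VecP.tabulate-cong u≗v) (VecP.tabulate∘lookup v))

  ⊖-⊕-shift : ∀ (u w e r : Vec ℚ n) → u ⊖ (w ⊕ (e ⊖ r)) ≡ (r ⊖ e) ⊕ (u ⊖ w)
  ⊖-⊕-shift u w e r = ≡-by-lookup _ _ (λ i → begin
    Vec.lookup (u ⊖ (w ⊕ (e ⊖ r))) i                      ≡⟨ lookup-⊖ u _ i ⟩
    Vec.lookup u i ℚ.- Vec.lookup (w ⊕ (e ⊖ r)) i         ≡⟨ cong (ℚ._-_ (Vec.lookup u i))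
                                                               (≡.trans (lookup-⊕ w _ i) (cong (ℚ._+_ (Vec.lookup w i)) (lookup-⊖ e r i))) ⟩
    Vec.lookup u i ℚ.- (Vec.lookup w i ℚ.+ (Vec.lookup e i ℚ.- Vec.lookup r i))
      ≡⟨ solve 4 (λ u w e r → u :- (w :+ (e :- r)) := (r :- e) :+ (u :- w)) refl
           (Vec.lookup u i) (Vec.lookup w i) (Vec.lookup e i) (Vec.lookup r i) ⟩
    (Vec.lookup r i ℚ.- Vec.lookup e i) ℚ.+ (Vec.lookup u i ℚ.- Vec.lookup w i)
      ≡⟨ ≡.sym (≡.trans (lookup-⊕ (r ⊖ e) _ i) (cong₂ ℚ._+_ (lookup-⊖ r e i) (lookup-⊖ u w i))) ⟩
    Vec.lookup ((r ⊖ e) ⊕ (u ⊖ w)) i                      ∎)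
    where open ≡-Reasoning

  -- z ≡ r modulo ⊕ ℤ V_i, in coordinates with respect to the V_i.
  Congruent : Vec ℚ n → Vec ℚ n → Set
  Congruent z r = ∀ i → IsInt (Vec.lookup z i ℚ.- Vec.lookup r i)

  congruentᵇ : Vec ℚ n → Vec ℚ n → Bool
  congruentᵇ r z = allᵇ (λ i → isIntᵇ (Vec.lookup z i ℚ.- Vec.lookup r i)) (allFin n)

  congruentᵇ⇒Congruent : ∀ r z → congruentᵇ r z ≡ true → Congruent z r
  congruentᵇ⇒Congruent r z z∼r i = isIntᵇ⇒IsInt _ (allᵇ-allFin-elim (λ i → isIntᵇ (Vec.lookup z i ℚ.- Vec.lookup r i)) z∼r i)

  Congruent⇒congruentᵇ : ∀ r z → Congruent z r → congruentᵇ r z ≡ true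
  Congruent⇒congruentᵇ r z z∼r = allᵇ-allFin-intro _ (λ i → IsInt⇒isIntᵇ _ (z∼r i))

  fracs-congruent : ∀ z → Congruent z (fracs z)
  fracs-congruent z i = IsInt-resp-≡ (cong (ℚ._-_ (Vec.lookup z i)) (≡.sym (lookup-fracs z i))) (IsInt-sub-frac (Vec.lookup z i))

  HasNonNaturalCoordinate : Vec ℚ n → Set
  HasNonNaturalCoordinate w = Σ (Fin n) (λ i → ∀ x → Vec.lookup w i ≢ ⟦ + x ⟧)

module Lattice {n : ℕ} (V : Basis n) where

  private
    sum : (Fin n → ℚ) → ℚ
    sum f = List.foldr (λ i acc → f i ℚ.+ acc) 0ℚ (allFin n)

    sum-cong : ∀ f g → (∀ i → f i ≡ g i) → sum f ≡ sum g
    sum-cong f g f≗g = go (allFin n)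
      where
      go : ∀ is → List.foldr (λ i acc → f i ℚ.+ acc) 0ℚ is ≡ List.foldr (λ i acc → g i ℚ.+ acc) 0ℚ is
      go []       = refl
      go (i ∷ is) = cong₂ ℚ._+_ (f≗g i) (go is)

    IsInt-sum : ∀ f → (∀ i → IsInt (f i)) → IsInt (sum f)
    IsInt-sum f f∈ℤ = go (allFin n)
      where
      go : ∀ is → IsInt (List.foldr (λ i acc → f i ℚ.+ acc) 0ℚ is)
      go []       = + 0 , refl
      go (i ∷ is) = IsInt-+ (f∈ℤ i) (go is)

    sum-+ : ∀ f g → sum (λ i → f i ℚ.+ g i) ≡ sum f ℚ.+ sum g
    sum-+ f g = go (allFin n)
      where
      go : ∀ is → List.foldr (λ i acc → (f i ℚ.+ g i) ℚ.+ acc) 0ℚ is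
                ≡ List.foldr (λ i acc → f i ℚ.+ acc) 0ℚ is ℚ.+ List.foldr (λ i acc → g i ℚ.+ acc) 0ℚ is
      go []       = refl
      go (i ∷ is) = ≡.trans (cong (ℚ._+_ (f i ℚ.+ g i)) (go is))
        (solve 4 (λ a b c d → (a :+ b) :+ (c :+ d) := (a :+ c) :+ (b :+ d)) refl (f i) (g i) _ _)

    sum-*ˡ : ∀ c f → sum (λ i → c ℚ.* f i) ≡ c ℚ.* sum f
    sum-*ˡ c f = go (allFin n)
      where
      go : ∀ is → List.foldr (λ i acc → c ℚ.* f i ℚ.+ acc) 0ℚ is ≡ c ℚ.* List.foldr (λ i acc → f i ℚ.+ acc) 0ℚ is
      go []       = ≡.sym (ℚP.*-zeroʳ c)
      go (i ∷ is) = ≡.trans (cong (ℚ._+_ (c ℚ.* f i)) (go is)) (≡.sym (ℚP.*-distribˡ-+ c (f i) _))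

    coordinate : Vec ℚ n → Fin n → Fin n → ℚ
    coordinate u j i = Vec.lookup u i ℚ.* (V i j ℚ./ 1)

  point-⊕ : ∀ u v j → point V (u ⊕ v) j ≡ point V u j ℚ.+ point V v j
  point-⊕ u v j = ≡.trans (sum-cong _ _ (λ i → ≡.trans (cong (ℚ._* (V i j ℚ./ 1)) (lookup-⊕ u v i))
                                                  (ℚP.*-distribʳ-+ (V i j ℚ./ 1) (Vec.lookup u i) (Vec.lookup v i))))
                          (sum-+ (coordinate u j) (coordinate v j))

  point-scale : ∀ c u j → point V (Vec.map (c ℚ.*_) u) j ≡ c ℚ.* point V u j
  point-scale c u j = ≡.trans (sum-cong _ _ (λ i → ≡.trans (cong (ℚ._* (V i j ℚ./ 1)) (VecP.lookup-map i (c ℚ.*_) u))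
                                                      (ℚP.*-assoc c (Vec.lookup u i) (V i j ℚ./ 1))))
                              (sum-*ˡ c (coordinate u j))

  IsLattice-resp-≗ : ∀ u v → (∀ i → Vec.lookup u i ≡ Vec.lookup v i) → IsLattice V u → IsLattice V v
  IsLattice-resp-≗ u v u≗v u∈ℤⁿ j = IsInt-resp-≡ (sum-cong _ _ (λ i → cong (ℚ._* (V i j ℚ./ 1)) (u≗v i))) (u∈ℤⁿ j)

  IsLattice-integral : ∀ u → (∀ i → IsInt (Vec.lookup u i)) → IsLattice V u
  IsLattice-integral u u∈ℤ j = IsInt-sum _ (λ i → IsInt-* (u∈ℤ i) (IsInt-⟦⟧ (V i j)))

  IsLattice-⊕ : ∀ u v → IsLattice V u → IsLattice V v → IsLattice V (u ⊕ v)
  IsLattice-⊕ u v u∈ℤⁿ v∈ℤⁿ j = IsInt-resp-≡ (≡.sym (point-⊕ u v j)) (IsInt-+ (u∈ℤⁿ j) (v∈ℤⁿ j))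

  IsLattice-scale : ∀ m u → IsLattice V u → IsLattice V (Vec.map (⟦ m ⟧ ℚ.*_) u)
  IsLattice-scale m u u∈ℤⁿ j = IsInt-resp-≡ (≡.sym (point-scale ⟦ m ⟧ u j)) (IsInt-* (IsInt-⟦⟧ m) (u∈ℤⁿ j))

  IsLattice-⊖ : ∀ u v → IsLattice V u → IsLattice V v → IsLattice V (u ⊖ v)
  IsLattice-⊖ u v u∈ℤⁿ v∈ℤⁿ j = IsInt-resp-≡ (≡.sym point-⊖)
    (IsInt-+ (u∈ℤⁿ j) (IsInt-* (IsInt-⟦⟧ -[1+ 0 ]) (v∈ℤⁿ j)))
    where
    point-⊖ : point V (u ⊖ v) j ≡ point V u j ℚ.+ ⟦ -[1+ 0 ] ⟧ ℚ.* point V v j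
    point-⊖ = begin
      point V (u ⊖ v) j
        ≡⟨ sum-cong _ _ (λ i → ≡.trans (cong (ℚ._* (V i j ℚ./ 1)) (lookup-⊖ u v i))
             (solve 3 (λ a b c → (a :- b) :* c := a :* c :+ con ⟦ -[1+ 0 ] ⟧ :* (b :* c)) refl
               (Vec.lookup u i) (Vec.lookup v i) (V i j ℚ./ 1))) ⟩
      sum (λ i → coordinate u j i ℚ.+ ⟦ -[1+ 0 ] ⟧ ℚ.* coordinate v j i)
        ≡⟨ sum-+ (coordinate u j) _ ⟩
      point V u j ℚ.+ sum (λ i → ⟦ -[1+ 0 ] ⟧ ℚ.* coordinate v j i)
        ≡⟨ cong (ℚ._+_ (point V u j)) (sum-*ˡ ⟦ -[1+ 0 ] ⟧ (coordinate v j)) ⟩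
      point V u j ℚ.+ ⟦ -[1+ 0 ] ⟧ ℚ.* point V v j ∎
      where open ≡-Reasoning

  IsLattice-map : ∀ m (f : ℚ → ℚ) → (∀ x → IsInt (⟦ m ⟧ ℚ.* x ℚ.- f x)) → ∀ u → IsLattice V u → IsLattice V (Vec.map f u)
  IsLattice-map m f mx-fx∈ℤ u u∈ℤⁿ = IsLattice-resp-≗ (mu ⊖ Vec.map g u) (Vec.map f u) fu≗
    (IsLattice-⊖ mu (Vec.map g u) (IsLattice-scale m u u∈ℤⁿ)
      (IsLattice-integral (Vec.map g u) (λ i → IsInt-resp-≡ (≡.sym (VecP.lookup-map i g u)) (mx-fx∈ℤ (Vec.lookup u i)))))
    where
    mu : Vec ℚ _
    mu = Vec.map (⟦ m ⟧ ℚ.*_) u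
    g : ℚ → ℚ
    g = λ x → ⟦ m ⟧ ℚ.* x ℚ.- f x
    fu≗ : ∀ i → Vec.lookup (mu ⊖ Vec.map g u) i ≡ Vec.lookup (Vec.map f u) i
    fu≗ i = ≡.trans (lookup-⊖ mu _ i) (≡.trans (cong₂ ℚ._-_ (VecP.lookup-map i _ u) (VecP.lookup-map i _ u))
      (≡.trans (solve 2 (λ a b → a :- (a :- b) := b) refl (⟦ m ⟧ ℚ.* Vec.lookup u i) (f (Vec.lookup u i)))
               (≡.sym (VecP.lookup-map i f u))))

-- Residue classes of Δ_k^± modulo ⊕ ℤ V_i

module ResidueClasses {n : ℕ} (V : Basis n) {p d : ℕ} (p⊥d : Coprime.Coprime p d) (denominators : DenomOK V d)
                      (k : ℕ) (s : PM) {Lk : List (Vec ℚ n)} (enumLk : Enumerates (InDelta V k s) Lk)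
                      {L1 : List (Vec ℚ n)} (enumL1 : Enumerates (InDelta V 1 minus) L1) where

  open Lattice V

  private
    lk : Vec ℚ n → Fin n → ℚ
    lk = Vec.lookup

  ∈Lk⇒ : ∀ {z} → z ∈ Lk → InDelta V k s z
  ∈Lk⇒ {z} = Equivalence.to (proj₂ enumLk z)

  ∈Lk⇐ : ∀ {z} → InDelta V k s z → z ∈ Lk
  ∈Lk⇐ {z} = Equivalence.from (proj₂ enumLk z)

  ∈L1⇒ : ∀ {r} → r ∈ L1 → InDelta V 1 minus r
  ∈L1⇒ {r} = Equivalence.to (proj₂ enumL1 r)

  ∈L1⇐ : ∀ {r} → InDelta V 1 minus r → r ∈ L1
  ∈L1⇐ {r} = Equivalence.from (proj₂ enumL1 r)

  InUnitCube : Vec ℚ n → Set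
  InUnitCube x = ∀ i → InUnitInterval (lk x i)

  ∈L1⇒InUnitCube : ∀ {r} → r ∈ L1 → InUnitCube r
  ∈L1⇒InUnitCube r∈ = proj₂ (∈L1⇒ r∈)

  ∈L1⇒denominators : ∀ {r} → r ∈ L1 → ∀ i → IsInt (⟦ + d ⟧ ℚ.* lk r i)
  ∈L1⇒denominators {r} r∈ = denominators r (proj₁ (∈L1⇒ r∈) , λ i → proj₁ (∈L1⇒InUnitCube r∈ i))

  η-InUnitCube : ∀ r → InUnitCube (η p r)
  η-InUnitCube r i = subst InUnitInterval (≡.sym (lookup-η p r i)) (frac-inUnitInterval (⟦ + p ⟧ ℚ.* lk r i))

  IsInt-scale-sub-η : ∀ r i → IsInt (⟦ + p ⟧ ℚ.* lk r i ℚ.- lk (η p r) i)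
  IsInt-scale-sub-η r i = IsInt-resp-≡ (cong (ℚ._-_ (⟦ + p ⟧ ℚ.* lk r i)) (≡.sym (lookup-η p r i)))
    (IsInt-sub-frac (⟦ + p ⟧ ℚ.* lk r i))

  IsLattice-η : ∀ r → IsLattice V r → IsLattice V (η p r)
  IsLattice-η = IsLattice-map (+ p) _ (λ x → IsInt-sub-frac (⟦ + p ⟧ ℚ.* x))

  η-≡0 : ∀ r i → lk r i ≡ 0ℚ → lk (η p r) i ≡ 0ℚ
  η-≡0 r i r≡0 = ≡.trans (lookup-η p r i) (≡.trans (cong (λ t → frac (⟦ + p ⟧ ℚ.* t)) r≡0) (cong frac (ℚP.*-zeroʳ ⟦ + p ⟧)))

  -- η(r)_i = 0 makes p r_i integral; so is d r_i, and gcd(p, d) = 1.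
  η-≡0⇒≡0 : ∀ {r} → r ∈ L1 → ∀ i → lk (η p r) i ≡ 0ℚ → lk r i ≡ 0ℚ
  η-≡0⇒≡0 {r} r∈ i ηr≡0 = IsInt⇒≡0 (∈L1⇒InUnitCube r∈ i) (IsInt-from-coprime-multiples p⊥d pr∈ℤ (∈L1⇒denominators r∈ i))
    where
    pr∈ℤ : IsInt (⟦ + p ⟧ ℚ.* lk r i)
    pr∈ℤ = IsInt-resp-≡ (≡.trans (cong (ℚ._-_ (⟦ + p ⟧ ℚ.* lk r i)) ηr≡0) (ℚP.+-identityʳ _)) (IsInt-scale-sub-η r i)

  Congruent-unique : ∀ {x y z} → InUnitCube x → InUnitCube y → Congruent z x → Congruent z y → x ≡ y
  Congruent-unique {x} {y} {z} x∈ y∈ z∼x z∼y = ≡-by-lookup x y (λ i → IsInt-diff⇒≡ (x∈ i) (y∈ i)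
    (IsInt-resp-≡ (solve 3 (λ z a b → (z :- b) :- (z :- a) := a :- b) refl (lk z i) (lk x i) (lk y i)) (IsInt-diff (z∼y i) (z∼x i))))

  η-injective : ∀ {r r′} → r ∈ L1 → r′ ∈ L1 → η p r ≡ η p r′ → r ≡ r′
  η-injective {r} {r′} r∈ r′∈ ηr≡ηr′ = ≡-by-lookup r r′ (λ i →
    IsInt-diff⇒≡ (∈L1⇒InUnitCube r∈ i) (∈L1⇒InUnitCube r′∈ i) (IsInt-from-coprime-multiples p⊥d (p[r-r′] i) (d[r-r′] i)))
    where
    p[r-r′] : ∀ i → IsInt (⟦ + p ⟧ ℚ.* (lk r i ℚ.- lk r′ i))
    p[r-r′] i = IsInt-resp-≡
      (solve 5 (λ P a b x y → (P :* a :- x) :- (P :* b :- y) :+ (x :- y) := P :* (a :- b)) refl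
        ⟦ + p ⟧ (lk r i) (lk r′ i) (lk (η p r) i) (lk (η p r′) i))
      (IsInt-+ (IsInt-diff (IsInt-scale-sub-η r i) (IsInt-scale-sub-η r′ i))
               (IsInt-resp-≡ (≡.sym (≡.trans (cong (ℚ._-_ (lk (η p r) i)) (cong (λ v → lk v i) (≡.sym ηr≡ηr′)))
                                             (ℚP.+-inverseʳ (lk (η p r) i))))
                 (+ 0 , refl)))
    d[r-r′] : ∀ i → IsInt (⟦ + d ⟧ ℚ.* (lk r i ℚ.- lk r′ i))
    d[r-r′] i = IsInt-resp-≡ (solve 3 (λ d a b → d :* a :- d :* b := d :* (a :- b)) refl ⟦ + d ⟧ (lk r i) (lk r′ i))
      (IsInt-diff (∈L1⇒denominators r∈ i) (∈L1⇒denominators r′∈ i))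

  fracs-∈L1 : ∀ {z} → z ∈ Lk → fracs z ∈ L1
  fracs-∈L1 {z} z∈ = ∈L1⇐ (IsLattice-map (+ 1) frac frac-integral z (proj₁ (∈Lk⇒ z∈)) ,
    λ i → subst InUnitInterval (≡.sym (lookup-fracs z i)) (frac-inUnitInterval (lk z i)))
    where
    frac-integral : ∀ x → IsInt (1ℚ ℚ.* x ℚ.- frac x)
    frac-integral x = IsInt-resp-≡ (cong (ℚ._- frac x) (≡.sym (ℚP.*-identityˡ x))) (IsInt-sub-frac x)

  Congruent-≡0 : ∀ {r z} → r ∈ L1 → Congruent z r → ∀ i → lk z i ≡ 0ℚ → lk r i ≡ 0ℚ
  Congruent-≡0 {r} {z} r∈ z∼r i z≡0 = IsInt⇒≡0 (∈L1⇒InUnitCube r∈ i) (IsInt-resp-≡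
    (≡.trans (cong (λ t → ℚ.- (t ℚ.- lk r i)) z≡0) (solve 1 (λ r → :- (con 0ℚ :- r) := r) refl (lk r i))) (IsInt-neg (z∼r i)))

  translate-∈Lk : ∀ {x y} → IsLattice V x → IsLattice V y → InUnitCube x → InUnitCube y →
    (∀ i → lk x i ≡ 0ℚ → lk y i ≡ 0ℚ) → (∀ i → lk y i ≡ 0ℚ → lk x i ≡ 0ℚ) →
    ∀ {z} → z ∈ Lk → Congruent z x → z ⊕ (y ⊖ x) ∈ Lk × Congruent (z ⊕ (y ⊖ x)) y
  translate-∈Lk {x} {y} x∈ℤⁿ y∈ℤⁿ x∈ y∈ x≡0⇒ y≡0⇒ {z} z∈ z∼x =
    ∈Lk⇐ (IsLattice-⊕ z (y ⊖ x) (proj₁ (∈Lk⇒ z∈)) (IsLattice-⊖ y x y∈ℤⁿ x∈ℤⁿ) , inRange) , w∼y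
    where
    w : Vec ℚ n
    w = z ⊕ (y ⊖ x)
    lookup-w : ∀ i → lk w i ≡ lk z i ℚ.+ (lk y i ℚ.- lk x i)
    lookup-w i = ≡.trans (lookup-⊕ z (y ⊖ x) i) (cong (ℚ._+_ (lk z i)) (lookup-⊖ y x i))
    w∼y : Congruent w y
    w∼y i = IsInt-resp-≡ (≡.trans (solve 3 (λ z y x → z :- x := (z :+ (y :- x)) :- y) refl (lk z i) (lk y i) (lk x i))
                                  (cong (ℚ._- lk y i) (≡.sym (lookup-w i)))) (z∼x i)
    inRange : ∀ i → InRange s k (lk w i)
    inRange i with lk x i ℚ.≟ 0ℚ
    ... | yes x≡0 = subst (InRange s k) z≡w (proj₂ (∈Lk⇒ z∈) i)
      where
      z≡w : lk z i ≡ lk w i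
      z≡w = ≡.sym (≡.trans (lookup-w i)
        (≡.trans (cong₂ (λ a b → lk z i ℚ.+ (a ℚ.- b)) (x≡0⇒ i x≡0) x≡0) (ℚP.+-identityʳ (lk z i))))
    ... | no x≢0 = subst (InRange s k) y+m≡w
      (InRange-transfer s k m (≢0⇒0< (proj₁ (x∈ i)) x≢0) (proj₂ (x∈ i))
                              (≢0⇒0< (proj₁ (y∈ i)) (x≢0 ∘ y≡0⇒ i)) (proj₂ (y∈ i))
        (subst (InRange s k) z≡x+m (proj₂ (∈Lk⇒ z∈) i)))
      where
      m : ℤ
      m = proj₁ (z∼x i)
      z-x≡m : lk z i ℚ.- lk x i ≡ ⟦ m ⟧
      z-x≡m = proj₂ (z∼x i)
      z≡x+m : lk z i ≡ lk x i ℚ.+ ⟦ m ⟧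
      z≡x+m = ≡.trans (solve 2 (λ z x → z := x :+ (z :- x)) refl (lk z i) (lk x i)) (cong (ℚ._+_ (lk x i)) z-x≡m)
      y+m≡w : lk y i ℚ.+ ⟦ m ⟧ ≡ lk w i
      y+m≡w = ≡.trans (cong (ℚ._+_ (lk y i)) (≡.sym z-x≡m))
        (≡.trans (solve 3 (λ y z x → y :+ (z :- x) := z :+ (y :- x)) refl (lk y i) (lk z i) (lk x i)) (≡.sym (lookup-w i)))

  -- The translation z ↦ z + η(r) − r carries the class of r onto the class of η(r).
  ψ ψ⁻¹ : Vec ℚ n → Vec ℚ n → Vec ℚ n
  ψ   r z = z ⊕ (η p r ⊖ r)
  ψ⁻¹ r w = w ⊕ (r ⊖ η p r)

  module _ {r} (r∈ : r ∈ L1) where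

    private
      r∈ℤⁿ : IsLattice V r
      r∈ℤⁿ = proj₁ (∈L1⇒ r∈)

    ψ-∈Lk : ∀ {z} → z ∈ Lk → Congruent z r → ψ r z ∈ Lk × Congruent (ψ r z) (η p r)
    ψ-∈Lk = translate-∈Lk r∈ℤⁿ (IsLattice-η r r∈ℤⁿ) (∈L1⇒InUnitCube r∈) (η-InUnitCube r) (η-≡0 r) (η-≡0⇒≡0 r∈)

    ψ⁻¹-∈Lk : ∀ {w} → w ∈ Lk → Congruent w (η p r) → ψ⁻¹ r w ∈ Lk × Congruent (ψ⁻¹ r w) r
    ψ⁻¹-∈Lk = translate-∈Lk (IsLattice-η r r∈ℤⁿ) r∈ℤⁿ (η-InUnitCube r) (∈L1⇒InUnitCube r∈) (η-≡0⇒≡0 r∈) (η-≡0 r)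

  ψ-ψ⁻¹ : ∀ r w → ψ r (ψ⁻¹ r w) ≡ w
  ψ-ψ⁻¹ r w = ≡-by-lookup _ _ (λ i →
    ≡.trans (lookup-⊕ (ψ⁻¹ r w) (η p r ⊖ r) i) (≡.trans (cong₂ ℚ._+_ (lookup-⊕ w (r ⊖ η p r) i) (lookup-⊖ (η p r) r i))
      (≡.trans (cong (λ t → (lk w i ℚ.+ t) ℚ.+ (lk (η p r) i ℚ.- lk r i)) (lookup-⊖ r (η p r) i))
        (solve 3 (λ w a b → (w :+ (a :- b)) :+ (b :- a) := w) refl (lk w i) (lk r i) (lk (η p r) i)))))

  ψ-injective : ∀ r {z z′} → ψ r z ≡ ψ r z′ → z ≡ z′
  ψ-injective r {z} {z′} ψz≡ψz′ = ≡-by-lookup z z′ (λ i → begin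
    lk z i                           ≡⟨ cancel (lk z i) (lk t i) ⟩
    (lk z i ℚ.+ lk t i) ℚ.- lk t i   ≡⟨ cong (ℚ._- lk t i) (≡.trans (≡.sym (lookup-⊕ z t i))
                                          (≡.trans (cong (λ v → lk v i) ψz≡ψz′) (lookup-⊕ z′ t i))) ⟩
    (lk z′ i ℚ.+ lk t i) ℚ.- lk t i  ≡⟨ ≡.sym (cancel (lk z′ i) (lk t i)) ⟩
    lk z′ i                          ∎)
    where
    open ≡-Reasoning
    t : Vec ℚ n
    t = η p r ⊖ r
    cancel : ∀ a b → a ≡ (a ℚ.+ b) ℚ.- b
    cancel = solve 2 (λ a b → a := (a :+ b) :- b) refl

  class target : Vec ℚ n → List (Vec ℚ n)
  class  r = filterᵇ (congruentᵇ r) Lk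
  target r = filterᵇ (congruentᵇ (η p r)) Lk

  ψ-class↭target : ∀ {r} → r ∈ L1 → target r ↭ map (ψ r) (class r)
  ψ-class↭target {r} r∈ = ∼bag⇒↭ (unique∧set⇒bag unique-target unique-ψ-class (mk⇔ to from))
    where
    unique-target : Unique (target r)
    unique-target = UniqueP.filter⁺ (T? ∘ congruentᵇ (η p r)) (proj₁ enumLk)
    unique-ψ-class : Unique (map (ψ r) (class r))
    unique-ψ-class = UniqueP.map⁺ (ψ-injective r) (UniqueP.filter⁺ (T? ∘ congruentᵇ r) (proj₁ enumLk))
    to : ∀ {w} → w ∈ target r → w ∈ map (ψ r) (class r)
    to {w} w∈ = subst (_∈ map (ψ r) (class r)) (ψ-ψ⁻¹ r w)
      (∈-map⁺ (ψ r) (∈-filterᵇ⁺ (congruentᵇ r) Lk (proj₁ ψ⁻¹w∈) (Congruent⇒congruentᵇ r (ψ⁻¹ r w) (proj₂ ψ⁻¹w∈))))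
      where
      w∈Lk : w ∈ Lk × congruentᵇ (η p r) w ≡ true
      w∈Lk = ∈-filterᵇ⁻ (congruentᵇ (η p r)) Lk w∈
      ψ⁻¹w∈ : ψ⁻¹ r w ∈ Lk × Congruent (ψ⁻¹ r w) r
      ψ⁻¹w∈ = ψ⁻¹-∈Lk r∈ (proj₁ w∈Lk) (congruentᵇ⇒Congruent (η p r) w (proj₂ w∈Lk))
    from : ∀ {w} → w ∈ map (ψ r) (class r) → w ∈ target r
    from {w} w∈ = subst (_∈ target r) (≡.sym w≡ψz)
      (∈-filterᵇ⁺ (congruentᵇ (η p r)) Lk (proj₁ ψz∈) (Congruent⇒congruentᵇ (η p r) (ψ r z) (proj₂ ψz∈)))
      where
      z : Vec ℚ n
      z = proj₁ (∈-map⁻ (ψ r) w∈)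
      z∈ : z ∈ class r
      z∈ = proj₁ (proj₂ (∈-map⁻ (ψ r) w∈))
      w≡ψz : w ≡ ψ r z
      w≡ψz = proj₂ (proj₂ (∈-map⁻ (ψ r) w∈))
      z∈Lk : z ∈ Lk × congruentᵇ r z ≡ true
      z∈Lk = ∈-filterᵇ⁻ (congruentᵇ r) Lk z∈
      ψz∈ : ψ r z ∈ Lk × Congruent (ψ r z) (η p r)
      ψz∈ = ψ-∈Lk r∈ (proj₁ z∈Lk) (congruentᵇ⇒Congruent r z (proj₂ z∈Lk))

  length-class≡length-target : ∀ {r} → r ∈ L1 → length (class r) ≡ length (target r)
  length-class≡length-target {r} r∈ =
    ≡.trans (≡.sym (ListP.length-map (ψ r) (class r))) (≡.sym (↭-length (ψ-class↭target r∈)))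

  private
    AllPairs-L1 : {P : Vec ℚ n → Vec ℚ n → Set} → (∀ {r r′} → r ∈ L1 → r′ ∈ L1 → r ≢ r′ → P r r′) → AllPairs P L1
    AllPairs-L1 {P} distinct⇒P = go L1 (proj₁ enumL1) (λ x∈ → x∈)
      where
      go : ∀ xs → Unique xs → (∀ {x} → x ∈ xs → x ∈ L1) → AllPairs P xs
      go []       _                   _   = AllPairs.[]
      go (x ∷ xs) (x∉xs AllPairs.∷ u) ⊆L1 =
        All.tabulate (λ y∈ → distinct⇒P (⊆L1 (here refl)) (⊆L1 (there y∈)) (All.lookup x∉xs y∈))
          AllPairs.∷ go xs u (⊆L1 ∘ there)

    disjoint : ∀ (c : Vec ℚ n → Vec ℚ n) {r r′} → r ≢ r′ → (∀ z → Congruent z (c r) → Congruent z (c r′) → r ≡ r′) →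
               ∀ z → congruentᵇ (c r) z ≡ true → congruentᵇ (c r′) z ≡ false
    disjoint c {r} {r′} r≢r′ unique z z∼r with congruentᵇ (c r′) z in z∼r′
    ... | false = refl
    ... | true  = ⊥-elim (r≢r′ (unique z (congruentᵇ⇒Congruent (c r) z z∼r) (congruentᵇ⇒Congruent (c r′) z z∼r′)))

  classes-disjoint : AllPairs (λ r r′ → ∀ z → congruentᵇ r z ≡ true → congruentᵇ r′ z ≡ false) L1
  classes-disjoint = AllPairs-L1 (λ {r} {r′} r∈ r′∈ r≢r′ →
    disjoint (λ r → r) r≢r′ (λ z → Congruent-unique {z = z} (∈L1⇒InUnitCube r∈) (∈L1⇒InUnitCube r′∈)))

  targets-disjoint : AllPairs (λ r r′ → ∀ w → congruentᵇ (η p r) w ≡ true → congruentᵇ (η p r′) w ≡ false) L1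
  targets-disjoint = AllPairs-L1 (λ {r} {r′} r∈ r′∈ r≢r′ →
    disjoint (η p) r≢r′ (λ w w∼ηr w∼ηr′ →
      η-injective r∈ r′∈ (Congruent-unique {z = w} (η-InUnitCube r) (η-InUnitCube r′) w∼ηr w∼ηr′)))

  classes-cover : ∀ z → z ∈ Lk → Σ (Vec ℚ n) (λ r → r ∈ L1 × congruentᵇ r z ≡ true)
  classes-cover z z∈ = fracs z , fracs-∈L1 z∈ , Congruent⇒congruentᵇ (fracs z) z (fracs-congruent z)

  -- p z − w ≡ η(r) − w modulo ℤⁿ for z in the class of r.
  scale-⊖-nonNatural : ∀ {r z w} → Congruent z r → congruentᵇ (η p r) w ≡ false → HasNonNaturalCoordinate (scale p z ⊖ w)
  scale-⊖-nonNatural {r} {z} {w} z∼r w≁ηr with allᵇ-false (λ i → isIntᵇ (lk w i ℚ.- lk (η p r) i)) (allFin n) w≁ηr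
  ... | i , _ , w-ηr∉ℤ = i , λ x pz-w≡x → BoolP.not-¬ (IsInt⇒isIntᵇ _ (IsInt-resp-≡ (w-ηr≡ x pz-w≡x) (integral x))) w-ηr∉ℤ
    where
    P : ℚ
    P = ⟦ + p ⟧
    integral : ∀ x → IsInt ((P ℚ.* (lk z i ℚ.- lk r i) ℚ.+ (P ℚ.* lk r i ℚ.- lk (η p r) i)) ℚ.- ⟦ + x ⟧)
    integral x = IsInt-diff (IsInt-+ (IsInt-* (IsInt-⟦⟧ (+ p)) (z∼r i)) (IsInt-scale-sub-η r i)) (IsInt-⟦⟧ (+ x))
    w-ηr≡ : ∀ x → lk (scale p z ⊖ w) i ≡ ⟦ + x ⟧ →
            (P ℚ.* (lk z i ℚ.- lk r i) ℚ.+ (P ℚ.* lk r i ℚ.- lk (η p r) i)) ℚ.- ⟦ + x ⟧ ≡ lk w i ℚ.- lk (η p r) i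
    w-ηr≡ x pz-w≡x = ≡.trans (cong (ℚ._-_ (P ℚ.* (lk z i ℚ.- lk r i) ℚ.+ (P ℚ.* lk r i ℚ.- lk (η p r) i)))
        (≡.trans (≡.sym pz-w≡x) (≡.trans (lookup-⊖ (scale p z) w i) (cong (ℚ._- lk w i) (lookup-scale p z i)))))
      (solve 5 (λ P z r e w → (P :* (z :- r) :+ (P :* r :- e)) :- (P :* z :- w) := w :- e) refl P (lk z i) (lk r i) (lk (η p r) i) (lk w i))

  -- Where z vanishes so do r and η(r), leaving the coordinate −w_i < 0.
  shift-nonNatural : ∀ {r} → r ∈ L1 → ∀ {z w} → w ∈ Lk → Congruent z r → ∀ i → lk z i ≡ 0ℚ → lk w i ≢ 0ℚ →
                     HasNonNaturalCoordinate ((r ⊖ η p r) ⊕ (scale p z ⊖ w))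
  shift-nonNatural {r} r∈ {z} {w} w∈ z∼r i z≡0 w≢0 =
    i , λ x coord≡x → w≢0 (ℚP.≤-antisym (w≤0 x coord≡x) (proj₁ (proj₂ (∈Lk⇒ w∈) i)))
    where
    r≡0 : lk r i ≡ 0ℚ
    r≡0 = Congruent-≡0 {z = z} r∈ z∼r i z≡0
    coord≡-w : lk ((r ⊖ η p r) ⊕ (scale p z ⊖ w)) i ≡ ℚ.- lk w i
    coord≡-w = ≡.trans (lookup-⊕ (r ⊖ η p r) (scale p z ⊖ w) i)
      (≡.trans (cong₂ ℚ._+_ (≡.trans (lookup-⊖ r (η p r) i) (cong₂ ℚ._-_ r≡0 (η-≡0 r i r≡0)))
                            (≡.trans (lookup-⊖ (scale p z) w i)
                              (cong (ℚ._- lk w i) (≡.trans (lookup-scale p z i) (≡.trans (cong (ℚ._*_ ⟦ + p ⟧) z≡0) (ℚP.*-zeroʳ ⟦ + p ⟧))))))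
        (solve 1 (λ w → (con 0ℚ :- con 0ℚ) :+ (con 0ℚ :- w) := :- w) refl (lk w i)))
    w≤0 : ∀ x → lk ((r ⊖ η p r) ⊕ (scale p z ⊖ w)) i ≡ ⟦ + x ⟧ → lk w i ℚ.≤ 0ℚ
    w≤0 x coord≡x = subst (ℚ._≤ 0ℚ) (solve 1 (λ w → :- (:- w) := w) refl (lk w i))
      (ℚP.neg-antimono-≤ (subst (0ℚ ℚ.≤_) (≡.trans (≡.sym coord≡x) coord≡-w) (⟦⟧-mono-≤ {+ 0} {+ x} (ℤ.+≤+ ℕ.z≤n))))

  shapeᵇ : Subset n → Vec ℚ n → Bool
  shapeᵇ I z = allᵇ (λ i → if mem i I then isZeroᵇ (lk z i) else isPositiveᵇ (lk z i)) (allFin n)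

  inBlockᵇ : Subset n → Vec ℚ n → Vec ℚ n → Bool
  inBlockᵇ I r z = shapeᵇ I z ∧ congruentᵇ r z

  ⊆zerosᵇ : Vec ℚ n → Subset n → Bool
  ⊆zerosᵇ r I = allᵇ (λ i → not (mem i I) ∨ isZeroᵇ (lk r i)) (allFin n)

  zeros : Vec ℚ n → Vec Bool n
  zeros = Vec.map isZeroᵇ

  Vec-≡ᵇ-zeros : ∀ {z} → z ∈ Lk → ∀ I → Vec-≡ᵇ (zeros z) I ≡ shapeᵇ I z
  Vec-≡ᵇ-zeros {z} z∈ I = ≡.trans (Vec-≡ᵇ-lookup (zeros z) I) (allᵇ-cong _ _ (allFin n) pointwise)
    where
    pointwise : ∀ i → (if Vec.lookup (zeros z) i then Vec.lookup I i else not (Vec.lookup I i))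
                      ≡ (if mem i I then isZeroᵇ (lk z i) else isPositiveᵇ (lk z i))
    pointwise i rewrite VecP.lookup-map i isZeroᵇ z | mem≡lookup i I
                      | isPositiveᵇ≡not-isZeroᵇ (proj₁ (proj₂ (∈Lk⇒ z∈) i)) with isZeroᵇ (lk z i) | Vec.lookup I i
    ... | true  | true  = refl
    ... | true  | false = refl
    ... | false | true  = refl
    ... | false | false = refl

  blocks-≡ : ∀ r I → filterᵇ (λ z → Vec-≡ᵇ (zeros z) I) (class r) ≡ filterᵇ (inBlockᵇ I r) Lk
  blocks-≡ r I = ≡.trans (filterᵇ-filterᵇ _ (congruentᵇ r) Lk) (filterᵇ-cong _ _ Lk (λ z z∈ →
    ≡.trans (cong (congruentᵇ r z ∧_) (Vec-≡ᵇ-zeros z∈ I)) (BoolP.∧-comm (congruentᵇ r z) (shapeᵇ I z))))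

  -- A point of Δ_k^± ∩ (r + ℤⁿ) vanishing at i forces r_i = 0.
  block-empty : ∀ {r} → r ∈ L1 → ∀ I → ⊆zerosᵇ r I ≡ false → filterᵇ (inBlockᵇ I r) Lk ≡ []
  block-empty {r} r∈ I I⊈ = filterᵇ-none (inBlockᵇ I r) Lk notInBlock
    where
    notInBlock : ∀ z → z ∈ Lk → inBlockᵇ I r z ≡ false
    notInBlock z _ with inBlockᵇ I r z in inBlock
    ... | false = refl
    ... | true  = ⊥-elim (BoolP.not-¬ (allᵇ-allFin-intro _ ⊆zeros) I⊈)
      where
      z∈I,r : shapeᵇ I z ≡ true × congruentᵇ r z ≡ true
      z∈I,r = ∧-≡true⁻ {shapeᵇ I z} inBlock
      ⊆zeros : ∀ i → not (mem i I) ∨ isZeroᵇ (lk r i) ≡ true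
      ⊆zeros i with mem i I | allᵇ-allFin-elim _ (proj₁ z∈I,r) i
      ... | false | _     = refl
      ... | true  | z≡0 =
        ≡0⇒isZeroᵇ (Congruent-≡0 {z = z} r∈ (congruentᵇ⇒Congruent r z (proj₂ z∈I,r)) i (isZeroᵇ⇒≡0 {lk z i} z≡0))

module Coefficients (R : CommutativeRing 0ℓ 0ℓ) (ι : ℚ → CommutativeRing.Carrier R) where

  open CommutativeRing R using (0#)
  open Alg R ι using (toℕ?; toℕVec?; eres)

  toℕ?-just : ∀ q x → toℕ? q ≡ just x → q ≡ ⟦ + x ⟧
  toℕ?-just (mkℚ (+ _)    0           _) _ refl = ≡.sym (⟦⟧≡mkℚ _)
  toℕ?-just (mkℚ (+ _)    (ℕ.suc _) _) _ ()
  toℕ?-just (mkℚ -[1+ _ ] _           _) _ ()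

  toℕVec?-just : ∀ {m} (w : Vec ℚ m) w′ → toℕVec? w ≡ just w′ → ∀ i → Vec.lookup w i ≡ ⟦ + Vec.lookup w′ i ⟧
  toℕVec?-just (q ∷ qs) w′ eq i with toℕ? q in q≡x | toℕVec? qs in qs≡xs
  toℕVec?-just (q ∷ qs) _ refl Fin.zero    | just x | just _  = toℕ?-just q x q≡x
  toℕVec?-just (q ∷ qs) _ refl (Fin.suc i) | just _ | just xs = toℕVec?-just qs xs qs≡xs i

  -- x^Q occurs only for Q = Σ w_i V_i with all w_i ∈ ℕ.
  eres-nonNatural : ∀ {m} p π a (w : Vec ℚ m) → HasNonNaturalCoordinate w → eres p π a w ≡ 0#
  eres-nonNatural p π a w (i , w-i∉ℕ) with toℕVec? w in w≡w′
  ... | just w′ = ⊥-elim (w-i∉ℕ (Vec.lookup w′ i) (toℕVec?-just w w′ w≡w′ i))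
  ... | nothing = refl


-- The factorisation for p prime to D

module Factorisation {n : ℕ} (V : Basis n) {p D : ℕ} (p⊥D : Coprime.Coprime p D) (denominators : DenomOK V D)
                     (k : ℕ) (s : PM) {Lk : List (Vec ℚ n)} (enumLk : Enumerates (InDelta V k s) Lk)
                     {L1 : List (Vec ℚ n)} (enumL1 : Enumerates (InDelta V 1 minus) L1)
                     (R : CommutativeRing 0ℓ 0ℓ) (ι : ℚ → CommutativeRing.Carrier R)
                     (π : CommutativeRing.Carrier R) (a : ℕ → CommutativeRing.Carrier R) where

  open CommutativeRing R using (Carrier; _≈_; reflexive; sym; trans)
  open Det R using (det; prodL)
  open Signs R
  open Determinant R
  open Coefficients R ι
  open Alg R ι using (eres; lhs; rhs)
  open ResidueClasses V p⊥D denominators k s enumLk enumL1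

  M : Vec ℚ n → Vec ℚ n → Carrier
  M z w = eres p π a (scale p z ⊖ w)

  N : Vec ℚ n → Vec ℚ n → Vec ℚ n → Carrier
  N r z w = eres p π a ((r ⊖ η p r) ⊕ (scale p z ⊖ w))

  byClasses : det M Lk Lk ≈± prodL (λ r → det M (class r) (target r)) L1
  byClasses = det-splitByClasses M congruentᵇ (congruentᵇ ∘ η p) L1 Lk Lk
    (λ r z w _ _ z∼r w≁ηr → reflexive (eres-nonNatural p π a (scale p z ⊖ w)
      (scale-⊖-nonNatural {r} {z} {w} (congruentᵇ⇒Congruent r z z∼r) w≁ηr)))
    (λ r → length-class≡length-target) classes-disjoint targets-disjoint classes-cover refl

  byTranslation : prodL (λ r → det M (class r) (target r)) L1 ≈± prodL (λ r → det (N r) (class r) (class r)) L1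
  byTranslation = prodL-≈± _ _ L1 λ r r∈ →
    ≈±-trans (det-permuteColumns M (ψ-class↭target r∈) (class r) (length-class≡length-target r∈))
      (≈⇒≈± (trans (reflexive (≡.sym (det-mapColumns M (ψ r) (class r) (class r))))
        (det-cong _ (N r) (λ z w → reflexive (cong (eres p π a) (⊖-⊕-shift (scale p z) w (η p r) r))) (class r) (class r))))

  byShapes : prodL (λ r → det (N r) (class r) (class r)) L1 ≈± prodL (λ r → diagonalBlocks zeros (N r) (class r)) L1
  byShapes = prodL-≈± _ _ L1 λ r r∈ → det-splitByShape n zeros (N r) (class r) λ z w z∈ w∈ i z≡0 w≢0 →
    reflexive (eres-nonNatural p π a ((r ⊖ η p r) ⊕ (scale p z ⊖ w))
      (shift-nonNatural r∈ {z} {w} (proj₁ (∈-filterᵇ⁻ (congruentᵇ r) Lk w∈))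
        (congruentᵇ⇒Congruent r z (proj₂ (∈-filterᵇ⁻ (congruentᵇ r) Lk z∈))) i
        (isZeroᵇ⇒≡0 (≡.trans (≡.sym (VecP.lookup-map i isZeroᵇ z)) z≡0))
        (isZeroᵇ-false⇒≢0 (≡.trans (≡.sym (VecP.lookup-map i isZeroᵇ w)) w≢0))))

  byBookkeeping : prodL (λ r → diagonalBlocks zeros (N r) (class r)) L1 ≈ rhs p π a Lk L1
  byBookkeeping = prodL-cong _ _ L1 λ r r∈ → trans
    (prodL-cong _ _ (allSubsets n) (λ I _ → reflexive (cong (λ l → det (N r) l l) (blocks-≡ r I))))
    (sym (prodL-filterᵇ _ (⊆zerosᵇ r) (allSubsets n)
      (λ I _ I⊈ → reflexive (cong (λ l → det (N r) l l) (block-empty r∈ I I⊈)))))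

  lhs≈±rhs : lhs p π a Lk ≈± rhs p π a Lk L1
  lhs≈±rhs = ≈±-trans byClasses (≈±-trans byTranslation (≈±-respʳ byBookkeeping byShapes))

open import Data.Nat using (_+_; _*_)

proposition5p8 : (n : ℕ) → 1 ≤ n → (V : Basis n) → LinIndep V →
    (p : ℕ) → Prime p → ¬ (p ∣ Vol V) →
    (D : ℕ) → IsD V D → (n + 4) * D < p →
    (k : ℕ) → 1 ≤ k → (s : PM) →
    (Lk : List (Vec ℚ n)) → Enumerates (InDelta V k s) Lk →
    (L1 : List (Vec ℚ n)) → Enumerates (InDelta V 1 minus) L1 →
    (R : CommutativeRing 0ℓ 0ℓ) → (ι : ℚ → CommutativeRing.Carrier R) → QAlgebraHom R ι →
    (π : CommutativeRing.Carrier R) → (a : ℕ → CommutativeRing.Carrier R) →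
    CommutativeRing._≈_ R (Alg.lhs R ι p π a Lk) (Alg.rhs R ι p π a Lk L1)
      ⊎ CommutativeRing._≈_ R (Alg.lhs R ι p π a Lk)
          (CommutativeRing.-_ R (Alg.rhs R ι p π a Lk L1))
-- Only gcd(p, D) = 1 and the denominator property of D are used.
proposition5p8 n _ V _ p p-prime _ D (0<D , denominators , _) bound k _ s Lk enumLk L1 enumL1 R ι _ π a =
  Signs.≈±⇒≈⊎≈- R (Factorisation.lhs≈±rhs V p⊥D denominators k s enumLk enumL1 R ι π a)
  where
  D≤[n+4]D : D ≤ (n + 4) * D
  D≤[n+4]D = ℕP.m≤n*m D (n + 4) {{ℕ.>-nonZero (ℕP.≤-trans (ℕ.s≤s ℕ.z≤n) (ℕP.m≤n+m 4 n))}}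

  p⊥D : Coprime.Coprime p D
  p⊥D = Coprime.prime⇒coprime p-prime {{ℕ.>-nonZero 0<D}} (ℕP.≤-<-trans D≤[n+4]D bound)
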